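{- Let $\mathbb{F}$ be a field, $M \in \mathbb{F}^{r \times n}$, $A, B \subseteq [n]$ with $|A|=|B|=r$, $X \subseteq A \setminus B$, and $Y \subseteq B \setminus A$ with $|X| > |Y|$. Then $$\sum_{h=|Y|}^{|X|} (-1)^h \sum_{\substack{U \subseteq X,\ |U|=h \\ V \subseteq B \setminus A,\ |V|=h,\ Y \subseteq V}} \mu^M_{A,B}(U,V) = 0.$$
   Context: $[n]=\{1,\dots,n\}$. For $J\subseteq[n]$, $M[J]$ is the submatrix of $M$ consisting of the columns indexed by $J$ in increasing order. For $U = \{u_1< \dotsb< u_k\} \subseteq A$ and $V = \{v_1< \dotsb< v_k\} \subseteq [n] \setminus A$, $M[A; -U, +V]$ denotes the matrix obtained from $M[A]$ by replacing each column $u_i$ by column $v_i$ in the position of $u_i$; similarly $M[B; +U, -V]$ (for $V\subseteq B$, $U\cap B=\emptyset$) is obtained from $M[B]$ by replacing column $v_i$ by column $u_i$ in the position of $v_i$. Define $\mu^M_{A,B}(U,V) := \det M[A; -U, +V]\cdot\det M[B; +U, -V]$. -}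

module Defs where

open import Level using (_⊔_) renaming (suc to lsuc)
open import Algebra.Bundles using (CommutativeRing)
open import Data.Nat as ℕ using (ℕ; zero; suc; _∸_)
open import Data.Bool using (true; false; if_then_else_)
open import Data.Fin as Fin using (Fin; toℕ; punchIn)
open import Data.Fin.Subset using (Subset; inside; outside; _⊆_; ∣_∣; _─_)
open import Data.Fin.Subset.Properties using (_⊆?_)
open import Data.List as List using (List; []; _∷_; _++_; map; zip; filter; foldr; allFin; upTo)
open import Data.Maybe using (Maybe; just; nothing; maybe)
open import Data.Product using (_×_; _,_; ∃)
open import Data.Vec using (Vec) renaming ([] to []ᵥ; _∷_ to _∷ᵥ_)
open import Relation.Nullary using (¬_; does)
open import Relation.Nullary.Decidable using (_×-dec_)

record Field c ℓ : Set (lsuc (c ⊔ ℓ)) where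
  field
    commutativeRing : CommutativeRing c ℓ
  open CommutativeRing commutativeRing public
  field
    0≉1     : ¬ (0# ≈ 1#)
    inverse : ∀ x → ¬ (x ≈ 0#) → ∃ λ y → x * y ≈ 1#

elems : ∀ {n} → Subset n → List (Fin n)
elems []ᵥ              = []
elems (outside ∷ᵥ p)   = map Fin.suc (elems p)
elems (inside  ∷ᵥ p)   = Fin.zero ∷ map Fin.suc (elems p)

subsets : ∀ n → List (Subset n)
subsets zero    = []ᵥ ∷ []
subsets (suc n) = map (outside ∷ᵥ_) (subsets n) ++ map (inside ∷ᵥ_) (subsets n)

nth : ∀ {a} {X : Set a} → List X → ℕ → Maybe X
nth []       _       = nothing
nth (x ∷ xs) zero    = just x
nth (x ∷ xs) (suc k) = nth xs k

assoc : ∀ {n} → List (Fin n × Fin n) → Fin n → Fin n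
assoc []             j = j
assoc ((a , b) ∷ ps) j = if does (a Fin.≟ j) then b else assoc ps j

module _ {c ℓ} (R : CommutativeRing c ℓ) where
  open CommutativeRing R

  Σ-list : List Carrier → Carrier
  Σ-list = foldr _+_ 0#

  sign : ℕ → Carrier
  sign zero    = 1#
  sign (suc h) = - sign h

  det : ∀ k → (Fin k → Fin k → Carrier) → Carrier
  det zero    A = 1#
  det (suc k) A =
    Σ-list (map (λ j → sign (toℕ j) * A Fin.zero j
                        * det k (λ i j′ → A (Fin.suc i) (punchIn j j′)))
                (allFin (suc k)))

  -- the r × r matrix whose p-th column is column (p-th entry of L) of M;
  -- used only when length L = r
  cols : ∀ {r n} → (Fin r → Fin n → Carrier) → List (Fin n) → Fin r → Fin r → Carrier
  cols M L i p = maybe (M i) 0# (nth L (toℕ p))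

  -- μ^M_{A,B}(U,V) = det M[A; -U, +V] · det M[B; +U, -V]
  -- M[A; -U, +V]: columns of A in increasing order, with u_i replaced by v_i
  -- M[B; +U, -V]: columns of B in increasing order, with v_i replaced by u_i
  μ : ∀ {r n} → (Fin r → Fin n → Carrier) → (A B U V : Subset n) → Carrier
  μ {r} M A B U V =
    det r (cols M (map (assoc (zip (elems U) (elems V))) (elems A)))
    * det r (cols M (map (assoc (zip (elems V) (elems U))) (elems B)))

  lemmaSum : ∀ {r n} → (Fin r → Fin n → Carrier) → (A B X Y : Subset n) → Carrier
  lemmaSum {r} {n} M A B X Y =
    Σ-list (map (λ h → sign h * inner h)
                (map (∣ Y ∣ ℕ.+_) (upTo (suc (∣ X ∣ ∸ ∣ Y ∣)))))
    where
    inner : ℕ → Carrier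
    inner h =
      Σ-list (map (λ U →
        Σ-list (map (λ V → μ M A B U V)
          (filter (λ V → (V ⊆? (B ─ A)) ×-dec ((∣ V ∣ ℕ.≟ h) ×-dec (Y ⊆? V)))
                  (subsets n))))
        (filter (λ U → (U ⊆? X) ×-dec (∣ U ∣ ℕ.≟ h)) (subsets n)))

{-# OPTIONS --safe #-}
module Submission where

open import Defs
open import Data.Nat using (ℕ; _<_)
open import Data.Fin using (Fin)
open import Data.Fin.Subset using (Subset; _⊆_; ∣_∣; _─_)
open import Relation.Binary.PropositionalEquality using (_≡_)

open import Algebra.Bundles using (CommutativeRing)
open import Data.Bool using (true; false; if_then_else_)
open import Data.Fin as Fin using (zero; suc; toℕ; punchIn; _≟_)
open import Data.Fin.Properties using (pigeonhole; toℕ<n; ¬∀⟶∃¬)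
open import Data.Fin.Subset using (inside; outside; ⊥; _∈_; _∉_)
open import Data.Fin.Subset.Properties
  using (_⊆?_; _∈?_; drop-∷-⊆; out⊆; in⊆in; ⊆-trans; ⊥⊆; p─q⊆p; x∈p∧x∉q⇒x∈p─q; p⊆q⇒∣p∣≤∣q∣)
open import Data.List using (List; []; _∷_; _++_; map; filter; length; lookup; allFin; zip; upTo; applyUpTo)
open import Data.List.Properties
  using (map-++; map-∘; map-cong; map-id; map-tabulate; map-upTo; length-map; length-++; ++-assoc; ++-identityʳ)
open import Data.Maybe using (maybe)
open import Data.Nat as ℕ using (zero; suc; _∸_; _≤?_)
import Data.Nat.Properties as ℕₚ
open import Data.Nat.Tactic.RingSolver using (solve-∀)
open import Data.Product using (∃; ∃₂; _×_; _,_)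
open import Data.Vec using ([]; _∷_; here; there)
open import Data.Vec.Functional using (Vector; tail)
open import Function using (_∘_)
open import Level using (_⊔_)
open import Relation.Binary.Definitions using (tri<; tri≈; tri>)
import Relation.Binary.PropositionalEquality as ≡
open import Relation.Binary.PropositionalEquality using (_≢_; subst₂)
open import Relation.Nullary using (¬_; Dec; does; yes; no; contradiction)
open import Relation.Nullary.Decidable using (_×-dec_; _→-dec_; dec-true; dec-false)
open import Relation.Unary using (Decidable)

-- For alternating forms φ and ψ on lists of vectors, the shuffle of φ and ψ
-- over a list of entries is the signed sum, over all ways of sending each
-- entry to φ or to ψ (some entries being forced to φ), of the product of φ
-- and ψ on what they receive: the coproduct of the exterior algebra. It is
-- alternating in the entries that may go either way. Laplace expansion along
-- the first row writes the determinant as such a shuffle, which makes it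
-- alternating as well.
--
-- Shuffle det with det over the columns of A in increasing order, those in X
-- free and the others forced, followed by the columns of B, those in B ─ Y
-- free and those in Y forced. The term in which the columns of U ⊆ X and of
-- B ─ V go to the second factor equals (-1)^|U| μ(U,V) when V ⊆ B ─ A and
-- |V| = |U|, since the signs of the shuffle and those of the column
-- replacements in μ count the same inversions; every other term has a
-- repeated column or the wrong number of columns, so it vanishes. Hence the
-- shuffle is the sum of the statement, and being alternating in
-- |X| + r - |Y| > r free vectors of an r-dimensional space, it is 0.

module _ {c ℓ} (R : CommutativeRing c ℓ) where

  open CommutativeRing R hiding (zero)
  open import Algebra.Properties.Ring ring using (-‿distribˡ-*; -‿distribʳ-*; -‿involutive)
  open import Algebra.Properties.AbelianGroup +-abelianGroup using (⁻¹-∙-comm)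
  open import Algebra.Properties.Group +-group using (inverseˡ-unique)
  open import Algebra.Solver.Ring.NaturalCoefficients.Default commutativeSemiring
    using (solve; _:=_; _:+_; _:*_)
  open import Relation.Binary.Reasoning.Setoid setoid

  sgn : ℕ → Carrier
  sgn = sign R

  sgn-+ : ∀ m n → sgn (m ℕ.+ n) ≈ sgn m * sgn n
  sgn-+ zero    n = sym (*-identityˡ _)
  sgn-+ (suc m) n = trans (-‿cong (sgn-+ m n)) (-‿distribˡ-* (sgn m) (sgn n))

  sgn*sgn≈1 : ∀ m → sgn m * sgn m ≈ 1#
  sgn*sgn≈1 zero    = *-identityˡ 1#
  sgn*sgn≈1 (suc m) = begin
    - sgn m * - sgn m   ≈⟨ -‿distribˡ-* _ _ ⟨
    - (sgn m * - sgn m) ≈⟨ -‿cong (-‿distribʳ-* _ _) ⟨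
    - - (sgn m * sgn m) ≈⟨ -‿involutive _ ⟩
    sgn m * sgn m       ≈⟨ sgn*sgn≈1 m ⟩
    1#                  ∎

  sgn[m*m]≈sgn[m] : ∀ m → sgn (m ℕ.* m) ≈ sgn m
  sgn[m*m]≈sgn[m] zero    = refl
  sgn[m*m]≈sgn[m] (suc m) = -‿cong (begin
    sgn (m ℕ.+ m ℕ.* suc m)          ≡⟨ ≡.cong (λ k → sgn (m ℕ.+ k)) (ℕₚ.*-suc m m) ⟩
    sgn (m ℕ.+ (m ℕ.+ m ℕ.* m))      ≈⟨ trans (sgn-+ m _) (*-congˡ (sgn-+ m _)) ⟩
    sgn m * (sgn m * sgn (m ℕ.* m))  ≈⟨ *-assoc _ _ _ ⟨
    sgn m * sgn m * sgn (m ℕ.* m)    ≈⟨ trans (*-congʳ (sgn*sgn≈1 m)) (*-identityˡ _) ⟩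
    sgn (m ℕ.* m)                    ≈⟨ sgn[m*m]≈sgn[m] m ⟩
    sgn m                            ∎)

  sgn-suc-cancel : ∀ j x → sgn j * x + sgn (suc j) * x ≈ 0#
  sgn-suc-cancel j x = trans (+-congˡ (sym (-‿distribˡ-* (sgn j) x))) (-‿inverseʳ _)

  private
    0*x+0*y≈0 : ∀ x y → 0# * x + 0# * y ≈ 0#
    0*x+0*y≈0 x y = trans (+-cong (zeroˡ x) (zeroˡ y)) (+-identityʳ 0#)

    a*0+b*0≈0 : ∀ a b → a * 0# + b * 0# ≈ 0#
    a*0+b*0≈0 a b = trans (+-cong (zeroʳ a) (zeroʳ b)) (+-identityʳ 0#)

    -1*x+0*y≈-x : ∀ x y → - 1# * x + 0# * y ≈ - x
    -1*x+0*y≈-x x y = trans (+-cong (sym (-‿distribˡ-* 1# x)) (zeroˡ y)) (trans (+-identityʳ _) (-‿cong (*-identityˡ x)))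

    *-combination : ∀ s a b x y → s * (a * x + b * y) ≈ a * (s * x) + b * (s * y)
    *-combination = solve 5 (λ s a b x y → s :* (a :* x :+ b :* y) := a :* (s :* x) :+ b :* (s :* y)) refl

    combination-* : ∀ a b x y s → (a * x + b * y) * s ≈ a * (x * s) + b * (y * s)
    combination-* = solve 5 (λ a b x y s → (a :* x :+ b :* y) :* s := a :* (x :* s) :+ b :* (y :* s)) refl

    +-combination : ∀ s a b x₁ y₁ x₂ y₂ →
                    s * (a * x₁ + b * y₁) + (a * x₂ + b * y₂) ≈ a * (s * x₁ + x₂) + b * (s * y₁ + y₂)
    +-combination = solve 7 (λ s a b x₁ y₁ x₂ y₂ → s :* (a :* x₁ :+ b :* y₁) :+ (a :* x₂ :+ b :* y₂)
                                               := a :* (s :* x₁ :+ x₂) :+ b :* (s :* y₁ :+ y₂)) refl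

  ∑ : List Carrier → Carrier
  ∑ = Σ-list R

  ∑-++ : ∀ xs ys → ∑ (xs ++ ys) ≈ ∑ xs + ∑ ys
  ∑-++ []       ys = sym (+-identityˡ _)
  ∑-++ (x ∷ xs) ys = trans (+-congˡ (∑-++ xs ys)) (sym (+-assoc _ _ _))

  module _ {a} {A : Set a} where

    ∑-cong : ∀ {f g : A → Carrier} xs → (∀ x → f x ≈ g x) → ∑ (map f xs) ≈ ∑ (map g xs)
    ∑-cong []       f≈g = refl
    ∑-cong (x ∷ xs) f≈g = +-cong (f≈g x) (∑-cong xs f≈g)

    ∑-zero : ∀ {f : A → Carrier} xs → (∀ x → f x ≈ 0#) → ∑ (map f xs) ≈ 0#
    ∑-zero []       f≈0 = refl
    ∑-zero (x ∷ xs) f≈0 = trans (+-cong (f≈0 x) (∑-zero xs f≈0)) (+-identityˡ 0#)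

    ∑-+ : ∀ (f g : A → Carrier) xs → ∑ (map (λ x → f x + g x) xs) ≈ ∑ (map f xs) + ∑ (map g xs)
    ∑-+ f g []       = sym (+-identityˡ 0#)
    ∑-+ f g (x ∷ xs) = trans (+-congˡ (∑-+ f g xs))
      (solve 4 (λ a b c d → (a :+ b) :+ (c :+ d) := (a :+ c) :+ (b :+ d)) refl _ _ _ _)

    ∑-*ˡ : ∀ a (f : A → Carrier) xs → ∑ (map (λ x → a * f x) xs) ≈ a * ∑ (map f xs)
    ∑-*ˡ a f []       = sym (zeroʳ a)
    ∑-*ˡ a f (x ∷ xs) = trans (+-congˡ (∑-*ˡ a f xs)) (sym (distribˡ a _ _))

    ∑-filter : ∀ {p} {P : A → Set p} (P? : Decidable P) (f : A → Carrier) xs →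
               ∑ (map f (filter P? xs)) ≈ ∑ (map (λ x → if does (P? x) then f x else 0#) xs)
    ∑-filter P? f []       = refl
    ∑-filter P? f (x ∷ xs) with does (P? x)
    ... | true  = +-congˡ (∑-filter P? f xs)
    ... | false = trans (∑-filter P? f xs) (sym (+-identityˡ _))

  ∑-swap : ∀ {a b} {A : Set a} {B : Set b} (f : A → B → Carrier) xs ys →
           ∑ (map (λ x → ∑ (map (f x) ys)) xs) ≈ ∑ (map (λ y → ∑ (map (λ x → f x y) xs)) ys)
  ∑-swap f []       ys = sym (∑-zero ys (λ _ → refl))
  ∑-swap f (x ∷ xs) ys = trans (+-congˡ (∑-swap f xs ys)) (sym (∑-+ (f x) _ ys))

  ∑-allFin-suc : ∀ {k} (f : Fin (suc k) → Carrier) → ∑ (map f (allFin (suc k))) ≈ f zero + ∑ (map (f ∘ suc) (allFin k))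
  ∑-allFin-suc f = +-congˡ (reflexive (≡.cong ∑
    (≡.trans (map-tabulate suc f) (≡.sym (map-tabulate (λ t → t) (f ∘ suc))))))

  ∑-applyUpTo-δ : ∀ (g : ℕ → Carrier) len m → m < len → (∀ i → i ≢ m → g i ≈ 0#) → ∑ (applyUpTo g len) ≈ g m
  ∑-applyUpTo-δ g (suc len) zero    _             g≈0 =
    trans (+-congˡ (trans (reflexive (≡.cong ∑ (≡.sym (map-upTo (g ∘ suc) len))))
                          (∑-zero (upTo len) (λ i → g≈0 (suc i) (λ ())))))
          (+-identityʳ _)
  ∑-applyUpTo-δ g (suc len) (suc m) (ℕ.s≤s m<len) g≈0 =
    trans (+-cong (g≈0 zero (λ ()))
                  (∑-applyUpTo-δ (g ∘ suc) len m m<len (λ i i≢m → g≈0 (suc i) (i≢m ∘ ℕₚ.suc-injective))))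
          (+-identityˡ _)

  if-true : ∀ {p} {P : Set p} (P? : Dec P) {x} → P → (if does P? then x else 0#) ≈ x
  if-true P? {x} p = reflexive (≡.cong (λ b → if b then x else 0#) (dec-true P? p))

  if-false : ∀ {p} {P : Set p} (P? : Dec P) {x} → ¬ P → (if does P? then x else 0#) ≈ 0#
  if-false P? {x} ¬p = reflexive (≡.cong (λ b → if b then x else 0#) (dec-false P? ¬p))

  -- Alternating forms

  Form : ℕ → Set c
  Form k = List (Vector Carrier k) → Carrier

  record IsAlternating {k} (φ : Form k) : Set (c ⊔ ℓ) where
    field
      linear      : ∀ P Q a b {u v w : Vector Carrier k} → (∀ i → w i ≈ a * u i + b * v i) →
                    φ (P ++ w ∷ Q) ≈ a * φ (P ++ u ∷ Q) + b * φ (P ++ v ∷ Q)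
      alternating : ∀ P Q u → φ (P ++ u ∷ u ∷ Q) ≈ 0#

  ∷-isAlternating : ∀ {k} {φ : Form k} → IsAlternating φ → ∀ v → IsAlternating (φ ∘ (v ∷_))
  ∷-isAlternating alt v = record
    { linear      = λ P → linear (v ∷ P)
    ; alternating = λ P → alternating (v ∷ P)
    } where open IsAlternating alt

  module _ {k} {φ : Form k} (alt : IsAlternating φ) where
    open IsAlternating alt

    zero-column : ∀ P Q {w} → (∀ i → w i ≈ 0#) → φ (P ++ w ∷ Q) ≈ 0#
    zero-column P Q {w} w≈0 =
      trans (linear P Q 0# 0# {w} {w} (λ i → trans (w≈0 i) (sym (0*x+0*y≈0 _ _)))) (0*x+0*y≈0 _ _)

    additive : ∀ P Q {u v w} → (∀ i → w i ≈ u i + v i) → φ (P ++ w ∷ Q) ≈ φ (P ++ u ∷ Q) + φ (P ++ v ∷ Q)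
    additive P Q w≈u+v =
      trans (linear P Q 1# 1# (λ i → trans (w≈u+v i) (sym (+-cong (*-identityˡ _) (*-identityˡ _)))))
            (+-cong (*-identityˡ _) (*-identityˡ _))

    swap : ∀ u v Q → φ (u ∷ v ∷ Q) ≈ - φ (v ∷ u ∷ Q)
    swap u v Q = inverseˡ-unique _ _ (begin
      φ (u ∷ v ∷ Q) + φ (v ∷ u ∷ Q)                ≈⟨ +-cong (+-identityˡ _) (+-identityʳ _) ⟨
      (0# + φ (u ∷ v ∷ Q)) + (φ (v ∷ u ∷ Q) + 0#)  ≈⟨ +-cong (+-congʳ (alternating [] Q u)) (+-congˡ (alternating [] Q v)) ⟨
      (φ (u ∷ u ∷ Q) + φ (u ∷ v ∷ Q)) + (φ (v ∷ u ∷ Q) + φ (v ∷ v ∷ Q))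
                                                   ≈⟨ +-cong (additive (u ∷ []) Q (λ _ → refl))
                                                             (additive (v ∷ []) Q (λ _ → refl)) ⟨
      φ (u ∷ w ∷ Q) + φ (v ∷ w ∷ Q)                ≈⟨ additive [] (w ∷ Q) (λ _ → refl) ⟨
      φ (w ∷ w ∷ Q)                                ≈⟨ alternating [] Q w ⟩
      0#                                           ∎)
      where
      w : Vector Carrier k
      w i = u i + v i

  move : ∀ {k} {φ : Form k} → IsAlternating φ → ∀ M u Q → φ (M ++ u ∷ Q) ≈ sgn (length M) * φ (u ∷ M ++ Q)
  move alt []      u Q = sym (*-identityˡ _)
  move {φ = φ} alt (m ∷ M) u Q = begin
    φ (m ∷ M ++ u ∷ Q)                       ≈⟨ move (∷-isAlternating alt m) M u Q ⟩
    sgn (length M) * φ (m ∷ u ∷ M ++ Q)      ≈⟨ *-congˡ (swap alt m u (M ++ Q)) ⟩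
    sgn (length M) * - φ (u ∷ m ∷ M ++ Q)    ≈⟨ -‿distribʳ-* _ _ ⟨
    - (sgn (length M) * φ (u ∷ m ∷ M ++ Q))  ≈⟨ -‿distribˡ-* _ _ ⟩
    - sgn (length M) * φ (u ∷ m ∷ M ++ Q)    ∎

  duplicate : ∀ {k} {φ : Form k} → IsAlternating φ → ∀ P u M Q → φ (P ++ u ∷ M ++ u ∷ Q) ≈ 0#
  duplicate alt (p ∷ P) u M Q = duplicate (∷-isAlternating alt p) P u M Q
  duplicate {φ = φ} alt [] u M Q = begin
    φ (u ∷ M ++ u ∷ Q)                   ≈⟨ move (∷-isAlternating alt u) M u Q ⟩
    sgn (length M) * φ (u ∷ u ∷ M ++ Q)  ≈⟨ *-congˡ (IsAlternating.alternating alt [] (M ++ Q) u) ⟩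
    sgn (length M) * 0#                  ≈⟨ zeroʳ _ ⟩
    0#                                   ∎

  basis : ∀ {k} → Fin k → Vector Carrier k
  basis t i = if does (t ≟ i) then 1# else 0#

  basis-expansion : ∀ {k} (w : Vector Carrier k) i → w i ≈ ∑ (map (λ t → w t * basis t i) (allFin k))
  basis-expansion {suc k} w i = trans (split i) (sym (∑-allFin-suc (λ t → w t * basis t i)))
    where
    split : ∀ i → w i ≈ w zero * basis zero i + ∑ (map (λ t → w (suc t) * basis (suc t) i) (allFin k))
    split zero    = sym (trans (+-cong (*-identityʳ _) (∑-zero (allFin k) (λ _ → zeroʳ _))) (+-identityʳ _))
    split (suc i) = sym (trans (+-cong (zeroʳ _) (sym (basis-expansion (w ∘ suc) i))) (+-identityˡ _))

  linear-∑ : ∀ {k} {φ : Form k} → IsAlternating φ → ∀ {a} {T : Set a} P Q (e : T → Vector Carrier k)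
             (c : T → Carrier) (ts : List T) {w} → (∀ i → w i ≈ ∑ (map (λ t → c t * e t i) ts)) →
             φ (P ++ w ∷ Q) ≈ ∑ (map (λ t → c t * φ (P ++ e t ∷ Q)) ts)
  linear-∑ alt P Q e c []       w≈0 = zero-column alt P Q w≈0
  linear-∑ {φ = φ} alt P Q e c (t ∷ ts) {w} w≈ = begin
    φ (P ++ w ∷ Q)                                   ≈⟨ IsAlternating.linear alt P Q (c t) 1# {e t} {rest}
                                                          (λ i → trans (w≈ i) (+-congˡ (sym (*-identityˡ _)))) ⟩
    c t * φ (P ++ e t ∷ Q) + 1# * φ (P ++ rest ∷ Q)  ≈⟨ +-congˡ (*-identityˡ _) ⟩
    c t * φ (P ++ e t ∷ Q) + φ (P ++ rest ∷ Q)       ≈⟨ +-congˡ (linear-∑ alt P Q e c ts (λ _ → refl)) ⟩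
    c t * φ (P ++ e t ∷ Q) + ∑ (map (λ t → c t * φ (P ++ e t ∷ Q)) ts) ∎
    where
    rest : Vector Carrier _
    rest i = ∑ (map (λ t → c t * e t i) ts)

  length-∷ʳ : ∀ {a} {X : Set a} (xs : List X) x → length (xs ++ x ∷ []) ≡ suc (length xs)
  length-∷ʳ xs x = ≡.trans (length-++ xs) (ℕₚ.+-comm (length xs) 1)

  module _ {a} {A : Set a} where

    split-at : ∀ (xs : List A) i → ∃₂ λ P Q → xs ≡ P ++ lookup xs i ∷ Q
    split-at (x ∷ xs) zero    = [] , xs , ≡.refl
    split-at (x ∷ xs) (suc i) with P , Q , eq ← split-at xs i = x ∷ P , Q , ≡.cong (x ∷_) eq

    split-at-two : ∀ (xs : List A) i j → i Fin.< j → ∃₂ λ P M → ∃ λ Q → xs ≡ P ++ lookup xs i ∷ M ++ lookup xs j ∷ Q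
    split-at-two (x ∷ xs) zero    (suc j) _ with M , Q , eq ← split-at xs j = [] , M , Q , ≡.cong (x ∷_) eq
    split-at-two (x ∷ xs) (suc i) (suc j) (ℕ.s≤s i<j) with P , M , Q , eq ← split-at-two xs i j i<j =
      x ∷ P , M , Q , ≡.cong (x ∷_) eq

  has-repetition : ∀ {k} (ts : List (Fin k)) → k < length ts → ∃₂ λ P t → ∃₂ λ M Q → ts ≡ P ++ t ∷ M ++ t ∷ Q
  has-repetition ts k<∣ts∣ =
    let i , j , i<j , tᵢ≡tⱼ = pigeonhole k<∣ts∣ (lookup ts)
        P , M , Q , eq      = split-at-two ts i j i<j
    in P , lookup ts i , M , Q , ≡.trans eq (≡.cong (λ t → P ++ lookup ts i ∷ M ++ t ∷ Q) (≡.sym tᵢ≡tⱼ))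

  vanish : ∀ {k} {φ : Form k} → IsAlternating φ → ∀ vs → k < length vs → φ vs ≈ 0#
  vanish {k} {φ} alt vs = on-basis vs []
    where
    on-basis : ∀ Q ts → k < length ts ℕ.+ length Q → φ (map basis ts ++ Q) ≈ 0#
    on-basis [] ts k< with P , t , M , Q , ≡.refl ← has-repetition ts (≡.subst (k <_) (ℕₚ.+-identityʳ (length ts)) k<) =
      trans (reflexive (≡.cong φ (≡.trans (++-identityʳ _) (≡.trans (map-++ basis P _)
                                   (≡.cong (λ L → map basis P ++ basis t ∷ L) (map-++ basis M _))))))
            (duplicate alt (map basis P) (basis t) (map basis M) (map basis Q))
    on-basis (w ∷ Q) ts k< = begin
      φ (map basis ts ++ w ∷ Q)                                         ≈⟨ linear-∑ alt (map basis ts) Q basis w (allFin k)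
                                                                              (basis-expansion w) ⟩
      ∑ (map (λ t → w t * φ (map basis ts ++ basis t ∷ Q)) (allFin k))  ≈⟨ ∑-zero (allFin k) (λ t → trans (*-congˡ (extend t))
                                                                                                    (zeroʳ _)) ⟩
      0#                                                                ∎
      where
      extend : ∀ t → φ (map basis ts ++ basis t ∷ Q) ≈ 0#
      extend t = trans (reflexive (≡.cong φ (≡.trans (≡.sym (++-assoc (map basis ts) (basis t ∷ []) Q))
                                                     (≡.cong (_++ Q) (≡.sym (map-++ basis ts (t ∷ [])))))))
                       (on-basis Q (ts ++ t ∷ [])
                         (≡.subst (k <_) (≡.trans (ℕₚ.+-suc (length ts) (length Q))
                                                  (≡.cong (ℕ._+ length Q) (≡.sym (length-∷ʳ ts t))))
                                  k<))

  -- Shuffles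

  data Entry (k : ℕ) : Set c where
    fixed free : Vector Carrier k → Entry k

  -- shuffle j φ ψ E sums, over the ways of sending each free entry of E to φ
  -- or to ψ (fixed entries always go to φ), the product of φ and ψ on what
  -- they receive, an entry sent to φ being weighted by (-1)^(j + the number
  -- of entries sent to ψ before it).
  shuffle : ∀ {k} → ℕ → Form k → Form k → List (Entry k) → Carrier
  shuffle j φ ψ []            = φ [] * ψ []
  shuffle j φ ψ (fixed v ∷ E) = sgn j * shuffle j (φ ∘ (v ∷_)) ψ E
  shuffle j φ ψ (free v ∷ E)  = sgn j * shuffle j (φ ∘ (v ∷_)) ψ E + shuffle (suc j) φ (ψ ∘ (v ∷_)) E

  shuffle-linearˡ : ∀ {k} E j {φ φ₁ φ₂ ψ : Form k} a b → (∀ T → φ T ≈ a * φ₁ T + b * φ₂ T) →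
                    shuffle j φ ψ E ≈ a * shuffle j φ₁ ψ E + b * shuffle j φ₂ ψ E
  shuffle-linearˡ []            j a b φ≈ = trans (*-congʳ (φ≈ [])) (combination-* a b _ _ _)
  shuffle-linearˡ (fixed v ∷ E) j a b φ≈ =
    trans (*-congˡ (shuffle-linearˡ E j a b (φ≈ ∘ (v ∷_)))) (*-combination _ a b _ _)
  shuffle-linearˡ (free v ∷ E)  j a b φ≈ =
    trans (+-cong (*-congˡ (shuffle-linearˡ E j a b (φ≈ ∘ (v ∷_)))) (shuffle-linearˡ E (suc j) a b φ≈))
          (+-combination _ a b _ _ _ _)

  shuffle-linearʳ : ∀ {k} E j {φ ψ ψ₁ ψ₂ : Form k} a b → (∀ T → ψ T ≈ a * ψ₁ T + b * ψ₂ T) →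
                    shuffle j φ ψ E ≈ a * shuffle j φ ψ₁ E + b * shuffle j φ ψ₂ E
  shuffle-linearʳ []            j a b ψ≈ = trans (*-congˡ (ψ≈ [])) (*-combination _ a b _ _)
  shuffle-linearʳ (fixed v ∷ E) j a b ψ≈ =
    trans (*-congˡ (shuffle-linearʳ E j a b ψ≈)) (*-combination _ a b _ _)
  shuffle-linearʳ (free v ∷ E)  j a b ψ≈ =
    trans (+-cong (*-congˡ (shuffle-linearʳ E j a b ψ≈)) (shuffle-linearʳ E (suc j) a b (ψ≈ ∘ (v ∷_))))
          (+-combination _ a b _ _ _ _)

  shuffle-negˡ : ∀ {k} E j {φ φ′ ψ : Form k} → (∀ T → φ T ≈ - φ′ T) → shuffle j φ ψ E ≈ - shuffle j φ′ ψ E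
  shuffle-negˡ E j {φ′ = φ′} φ≈ =
    trans (shuffle-linearˡ E j {φ₂ = φ′} (- 1#) 0# (λ T → trans (φ≈ T) (sym (-1*x+0*y≈-x _ _)))) (-1*x+0*y≈-x _ _)

  shuffle-zeroˡ : ∀ {k} E j {φ ψ : Form k} → (∀ T → φ T ≈ 0#) → shuffle j φ ψ E ≈ 0#
  shuffle-zeroˡ E j {φ} φ≈0 =
    trans (shuffle-linearˡ E j {φ₁ = φ} {φ₂ = φ} 0# 0# (λ T → trans (φ≈0 T) (sym (0*x+0*y≈0 _ _)))) (0*x+0*y≈0 _ _)

  shuffle-zeroʳ : ∀ {k} E j {φ ψ : Form k} → (∀ T → ψ T ≈ 0#) → shuffle j φ ψ E ≈ 0#
  shuffle-zeroʳ E j {ψ = ψ} ψ≈0 =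
    trans (shuffle-linearʳ E j {ψ₁ = ψ} {ψ₂ = ψ} 0# 0# (λ T → trans (ψ≈0 T) (sym (0*x+0*y≈0 _ _)))) (0*x+0*y≈0 _ _)

  module _ {k : ℕ} where

    shuffle-linear : ∀ P Q j {φ ψ : Form k} → IsAlternating φ → IsAlternating ψ → ∀ a b {u v w} →
                     (∀ i → w i ≈ a * u i + b * v i) →
                     shuffle j φ ψ (map free (P ++ w ∷ Q)) ≈
                     a * shuffle j φ ψ (map free (P ++ u ∷ Q)) + b * shuffle j φ ψ (map free (P ++ v ∷ Q))
    shuffle-linear [] Q j φ-alt ψ-alt a b w≈ =
      trans (+-cong (*-congˡ (shuffle-linearˡ (map free Q) j a b (λ T → IsAlternating.linear φ-alt [] T a b w≈)))
                    (shuffle-linearʳ (map free Q) (suc j) a b (λ T → IsAlternating.linear ψ-alt [] T a b w≈)))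
            (+-combination _ a b _ _ _ _)
    shuffle-linear (p ∷ P) Q j φ-alt ψ-alt a b w≈ =
      trans (+-cong (*-congˡ (shuffle-linear P Q j (∷-isAlternating φ-alt p) ψ-alt a b w≈))
                    (shuffle-linear P Q (suc j) φ-alt (∷-isAlternating ψ-alt p) a b w≈))
            (+-combination _ a b _ _ _ _)

    shuffle-alternating : ∀ P Q j {φ ψ : Form k} → IsAlternating φ → IsAlternating ψ → ∀ u →
                          shuffle j φ ψ (map free (P ++ u ∷ u ∷ Q)) ≈ 0#
    shuffle-alternating [] Q j {φ} {ψ} φ-alt ψ-alt u = begin
      sgn j * (sgn j * shuffle j (φ ∘ (u ∷_) ∘ (u ∷_)) ψ E + X) +
      (sgn (suc j) * X + shuffle (suc (suc j)) φ (ψ ∘ (u ∷_) ∘ (u ∷_)) E)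
        ≈⟨ +-cong (*-congˡ (+-congʳ (*-congˡ (shuffle-zeroˡ E j (λ T → IsAlternating.alternating φ-alt [] T u)))))
                  (+-congˡ (shuffle-zeroʳ E (suc (suc j)) (λ T → IsAlternating.alternating ψ-alt [] T u))) ⟩
      sgn j * (sgn j * 0# + X) + (sgn (suc j) * X + 0#)
        ≈⟨ +-cong (*-congˡ (trans (+-congʳ (zeroʳ _)) (+-identityˡ X))) (+-identityʳ _) ⟩
      sgn j * X + sgn (suc j) * X
        ≈⟨ sgn-suc-cancel j X ⟩
      0# ∎
      where
      E : List (Entry k)
      E = map free Q
      X : Carrier
      X = shuffle (suc j) (φ ∘ (u ∷_)) (ψ ∘ (u ∷_)) E
    shuffle-alternating (p ∷ P) Q j φ-alt ψ-alt u =
      trans (+-cong (*-congˡ (shuffle-alternating P Q j (∷-isAlternating φ-alt p) ψ-alt u))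
                    (shuffle-alternating P Q (suc j) φ-alt (∷-isAlternating ψ-alt p) u))
            (trans (+-congʳ (zeroʳ _)) (+-identityʳ 0#))

  shuffle-isAlternating : ∀ {k} j {φ ψ : Form k} → IsAlternating φ → IsAlternating ψ →
                          IsAlternating (λ vs → shuffle j φ ψ (map free vs))
  shuffle-isAlternating j φ-alt ψ-alt = record
    { linear      = λ P Q → shuffle-linear P Q j φ-alt ψ-alt
    ; alternating = λ P Q → shuffle-alternating P Q j φ-alt ψ-alt
    }

  shuffle-swap-free-fixed : ∀ {k} j {φ ψ : Form k} → IsAlternating φ → ∀ y z E →
                       shuffle j φ ψ (free y ∷ fixed z ∷ E) ≈ - shuffle j φ ψ (fixed z ∷ free y ∷ E)
  shuffle-swap-free-fixed j {φ} {ψ} φ-alt y z E = begin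
    sgn j * (sgn j * shuffle j (φ ∘ (y ∷_) ∘ (z ∷_)) ψ E) + - sgn j * X
      ≈⟨ +-cong (*-congˡ (*-congˡ (shuffle-negˡ E j (λ T → swap φ-alt y z T)))) (sym (-‿distribˡ-* _ X)) ⟩
    sgn j * (sgn j * - W) + - (sgn j * X)
      ≈⟨ +-congʳ (trans (*-congˡ (sym (-‿distribʳ-* _ W))) (sym (-‿distribʳ-* _ _))) ⟩
    - (sgn j * (sgn j * W)) + - (sgn j * X)
      ≈⟨ ⁻¹-∙-comm _ _ ⟩
    - (sgn j * (sgn j * W) + sgn j * X)
      ≈⟨ -‿cong (distribˡ (sgn j) _ _) ⟨
    - (sgn j * (sgn j * W + X)) ∎
    where
    W X : Carrier
    W = shuffle j (φ ∘ (z ∷_) ∘ (y ∷_)) ψ E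
    X = shuffle (suc j) (φ ∘ (z ∷_)) (ψ ∘ (y ∷_)) E

  shuffle-fixed-to-front : ∀ {k} j {φ ψ : Form k} → IsAlternating φ → ∀ ys z E →
                     shuffle j φ ψ (map free ys ++ fixed z ∷ E) ≈ sgn (length ys) * shuffle j φ ψ (fixed z ∷ map free ys ++ E)
  shuffle-fixed-to-front j φ-alt []       z E = sym (*-identityˡ _)
  shuffle-fixed-to-front j {φ} {ψ} φ-alt (y ∷ ys) z E = begin
    sgn j * shuffle j (φ ∘ (y ∷_)) ψ (map free ys ++ fixed z ∷ E) + shuffle (suc j) φ (ψ ∘ (y ∷_)) (map free ys ++ fixed z ∷ E)
      ≈⟨ +-cong (*-congˡ (shuffle-fixed-to-front j (∷-isAlternating φ-alt y) ys z E)) (shuffle-fixed-to-front (suc j) φ-alt ys z E) ⟩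
    sgn j * (t * shuffle j (φ ∘ (y ∷_)) ψ rest) + t * shuffle (suc j) φ (ψ ∘ (y ∷_)) rest
      ≈⟨ solve 4 (λ s t x y → s :* (t :* x) :+ t :* y := t :* (s :* x :+ y)) refl (sgn j) t _ _ ⟩
    t * shuffle j φ ψ (free y ∷ rest)
      ≈⟨ *-congˡ (shuffle-swap-free-fixed j φ-alt y z (map free ys ++ E)) ⟩
    t * - shuffle j φ ψ (fixed z ∷ free y ∷ map free ys ++ E)
      ≈⟨ trans (sym (-‿distribʳ-* t _)) (-‿distribˡ-* t _) ⟩
    - t * shuffle j φ ψ (fixed z ∷ free y ∷ map free ys ++ E) ∎
    where
    t : Carrier
    t = sgn (length ys)
    rest : List (Entry _)
    rest = fixed z ∷ map free ys ++ E

  free-entries : ∀ {k} → List (Entry k) → ℕ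
  free-entries []            = 0
  free-entries (fixed _ ∷ E) = free-entries E
  free-entries (free _ ∷ E)  = suc (free-entries E)

  free-entries-++ : ∀ {k} (E E′ : List (Entry k)) → free-entries (E ++ E′) ≡ free-entries E ℕ.+ free-entries E′
  free-entries-++ []            E′ = ≡.refl
  free-entries-++ (fixed _ ∷ E) E′ = free-entries-++ E E′
  free-entries-++ (free _ ∷ E)  E′ = ≡.cong suc (free-entries-++ E E′)

  -- Moving the fixed entries to the front reduces this to the alternating
  -- shuffle of the free entries alone.
  shuffle-vanish : ∀ {k} j {φ ψ : Form k} → IsAlternating φ → IsAlternating ψ →
                   ∀ E → k < free-entries E → shuffle j φ ψ E ≈ 0#
  shuffle-vanish {k} j {ψ = ψ} φ-alt ψ-alt E k< = go E [] φ-alt k<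
    where
    go : ∀ E ys {φ} → IsAlternating φ → k < length ys ℕ.+ free-entries E → shuffle j φ ψ (map free ys ++ E) ≈ 0#
    go [] ys φ-alt k< = trans (reflexive (≡.cong (shuffle j _ ψ) (++-identityʳ (map free ys))))
                              (vanish (shuffle-isAlternating j φ-alt ψ-alt) ys (≡.subst (k <_) (ℕₚ.+-identityʳ _) k<))
    go (free y ∷ E) ys φ-alt k< =
      trans (reflexive (≡.cong (shuffle j _ ψ) (≡.trans (≡.sym (++-assoc (map free ys) (free y ∷ []) E))
                                                        (≡.cong (_++ E) (≡.sym (map-++ free ys (y ∷ [])))))))
            (go E (ys ++ y ∷ []) φ-alt (≡.subst (k <_) (≡.trans (ℕₚ.+-suc (length ys) _)
                                         (≡.cong (ℕ._+ free-entries E) (≡.sym (length-∷ʳ ys y))))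
                                         k<))
    go (fixed z ∷ E) ys {φ} φ-alt k< = begin
      shuffle j φ ψ (map free ys ++ fixed z ∷ E)
        ≈⟨ shuffle-fixed-to-front j φ-alt ys z E ⟩
      sgn (length ys) * (sgn j * shuffle j (φ ∘ (z ∷_)) ψ (map free ys ++ E))
        ≈⟨ *-congˡ (*-congˡ (go E ys (∷-isAlternating φ-alt z) k<)) ⟩
      sgn (length ys) * (sgn j * 0#)
        ≈⟨ trans (*-congˡ (zeroʳ _)) (zeroʳ _) ⟩
      0# ∎

  -- Determinants

  first-row : ∀ {k} → Form (suc k)
  first-row (v ∷ []) = v zero
  first-row _        = 0#

  -- Laplace expansion along the first row: one column goes to its first-row
  -- entry, the others to the minor.
  Det : ∀ k → Form k
  Det zero    []      = 1#
  Det zero    (_ ∷ _) = 0#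
  Det (suc k) vs      = shuffle 0 first-row (Det k ∘ map tail) (map free vs)

  first-row-isAlternating : ∀ {k} → IsAlternating (first-row {k})
  first-row-isAlternating = record { linear = linear ; alternating = alternating }
    where
    linear : ∀ P Q a b {u v w} → (∀ i → w i ≈ a * u i + b * v i) →
             first-row (P ++ w ∷ Q) ≈ a * first-row (P ++ u ∷ Q) + b * first-row (P ++ v ∷ Q)
    linear []          []      a b w≈ = w≈ zero
    linear []          (_ ∷ _) a b w≈ = sym (a*0+b*0≈0 a b)
    linear (_ ∷ [])    Q       a b w≈ = sym (a*0+b*0≈0 a b)
    linear (_ ∷ _ ∷ _) Q       a b w≈ = sym (a*0+b*0≈0 a b)
    alternating : ∀ P Q u → first-row (P ++ u ∷ u ∷ Q) ≈ 0#
    alternating []          Q u = refl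
    alternating (_ ∷ [])    Q u = refl
    alternating (_ ∷ _ ∷ _) Q u = refl

  ∘map-tail-isAlternating : ∀ {k} {φ : Form k} → IsAlternating φ → IsAlternating (φ ∘ map tail)
  ∘map-tail-isAlternating {φ = φ} alt = record { linear = linear′ ; alternating = alternating′ }
    where
    open IsAlternating alt
    linear′ : ∀ P Q a b {u v w} → (∀ i → w i ≈ a * u i + b * v i) →
              φ (map tail (P ++ w ∷ Q)) ≈ a * φ (map tail (P ++ u ∷ Q)) + b * φ (map tail (P ++ v ∷ Q))
    linear′ P Q a b {u} {v} {w} w≈ = begin
      φ (map tail (P ++ w ∷ Q))                    ≡⟨ ≡.cong φ (map-++ tail P (w ∷ Q)) ⟩
      φ (map tail P ++ tail w ∷ map tail Q)        ≈⟨ linear (map tail P) (map tail Q) a b (w≈ ∘ suc) ⟩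
      a * φ (map tail P ++ tail u ∷ map tail Q) + b * φ (map tail P ++ tail v ∷ map tail Q)
        ≡⟨ ≡.cong₂ (λ x y → a * φ x + b * φ y) (map-++ tail P (u ∷ Q)) (map-++ tail P (v ∷ Q)) ⟨
      a * φ (map tail (P ++ u ∷ Q)) + b * φ (map tail (P ++ v ∷ Q)) ∎
    alternating′ : ∀ P Q u → φ (map tail (P ++ u ∷ u ∷ Q)) ≈ 0#
    alternating′ P Q u = trans (reflexive (≡.cong φ (map-++ tail P (u ∷ u ∷ Q))))
                               (alternating (map tail P) (map tail Q) (tail u))

  Det-isAlternating : ∀ k → IsAlternating (Det k)
  Det-isAlternating zero    = record { linear = linear ; alternating = alternating }
    where
    linear : ∀ P Q a b {u v w} → (∀ i → w i ≈ a * u i + b * v i) →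
             Det zero (P ++ w ∷ Q) ≈ a * Det zero (P ++ u ∷ Q) + b * Det zero (P ++ v ∷ Q)
    linear []      Q a b _ = sym (a*0+b*0≈0 a b)
    linear (_ ∷ _) Q a b _ = sym (a*0+b*0≈0 a b)
    alternating : ∀ P Q u → Det zero (P ++ u ∷ u ∷ Q) ≈ 0#
    alternating []      Q u = refl
    alternating (_ ∷ _) Q u = refl
  Det-isAlternating (suc k) =
    shuffle-isAlternating 0 first-row-isAlternating (∘map-tail-isAlternating (Det-isAlternating k))

  remove : ∀ {a} {A : Set a} → List A → ℕ → List A
  remove []       _       = []
  remove (x ∷ xs) zero    = xs
  remove (x ∷ xs) (suc i) = x ∷ remove xs i

  length-remove : ∀ {a} {A : Set a} (L : List A) {i} → i < length L → suc (length (remove L i)) ≡ length L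
  length-remove (x ∷ L) {zero}  _             = ≡.refl
  length-remove (x ∷ L) {suc i} (ℕ.s≤s i<∣L∣) = ≡.cong suc (length-remove L i<∣L∣)

  nth-punchIn : ∀ {a} {A : Set a} (L : List A) {m} (j : Fin (suc m)) j′ →
                nth L (toℕ (punchIn j j′)) ≡ nth (remove L (toℕ j)) (toℕ j′)
  nth-punchIn []      j       j′       = ≡.refl
  nth-punchIn (x ∷ L) zero    j′       = ≡.refl
  nth-punchIn (x ∷ L) (suc j) zero     = ≡.refl
  nth-punchIn (x ∷ L) (suc j) (suc j′) = nth-punchIn L j j′

  shuffle-constˡ : ∀ {k} j {φ ψ : Form k} → (∀ v T → φ (v ∷ T) ≈ 0#) →
                   ∀ vs → shuffle j φ ψ (map free vs) ≈ φ [] * ψ vs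
  shuffle-constˡ j φ≈0 []       = refl
  shuffle-constˡ j φ≈0 (v ∷ vs) =
    trans (+-cong (*-congˡ (shuffle-zeroˡ (map free vs) j (φ≈0 v))) (shuffle-constˡ (suc j) φ≈0 vs))
          (trans (+-congʳ (zeroʳ _)) (+-identityˡ _))

  laplace : ∀ {k n} j (ψ : Form (suc k)) (f : Fin n → Vector Carrier (suc k)) L m → length L ≡ m →
            shuffle j first-row ψ (map free (map f L)) ≈
            ∑ (map (λ p → sgn (j ℕ.+ toℕ p) * maybe (λ x → f x zero) 0# (nth L (toℕ p)) * ψ (map f (remove L (toℕ p))))
                   (allFin m))
  laplace j ψ f []      zero    _   = zeroˡ _
  laplace j ψ f (x ∷ L) (suc m) len = begin
    sgn j * shuffle j (first-row ∘ (f x ∷_)) ψ (map free (map f L)) +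
    shuffle (suc j) first-row (ψ ∘ (f x ∷_)) (map free (map f L))
      ≈⟨ +-cong (*-congˡ (shuffle-constˡ j (λ _ _ → refl) (map f L)))
                (laplace (suc j) (ψ ∘ (f x ∷_)) f L m (ℕₚ.suc-injective len)) ⟩
    sgn j * (f x zero * ψ (map f L)) +
    ∑ (map (λ p → sgn (suc j ℕ.+ toℕ p) * maybe (λ y → f y zero) 0# (nth L (toℕ p)) * ψ (f x ∷ map f (remove L (toℕ p))))
           (allFin m))
      ≈⟨ +-cong (trans (sym (*-assoc _ _ _)) (*-congʳ (*-congʳ (reflexive (≡.cong sgn (≡.sym (ℕₚ.+-identityʳ j)))))))
                (∑-cong (allFin m) (λ p → *-congʳ (*-congʳ (reflexive (≡.cong sgn (≡.sym (ℕₚ.+-suc j (toℕ p)))))))) ⟩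
    term zero + ∑ (map (term ∘ suc) (allFin m))
      ≈⟨ ∑-allFin-suc term ⟨
    ∑ (map term (allFin (suc m))) ∎
    where
    term : Fin (suc m) → Carrier
    term p = sgn (j ℕ.+ toℕ p) * maybe (λ y → f y zero) 0# (nth (x ∷ L) (toℕ p)) * ψ (map f (remove (x ∷ L) (toℕ p)))

  det-cong : ∀ k {A B : Fin k → Fin k → Carrier} → (∀ i j → A i j ≈ B i j) → det R k A ≈ det R k B
  det-cong zero    A≈B = refl
  det-cong (suc k) A≈B = ∑-cong (allFin (suc k))
    (λ j → *-cong (*-congˡ (A≈B zero j)) (det-cong k (λ i j′ → A≈B (suc i) (punchIn j j′))))

  column : ∀ {k n} → (Fin k → Fin n → Carrier) → Fin n → Vector Carrier k
  column M j i = M i j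

  det-cols : ∀ {k n} (M : Fin k → Fin n → Carrier) L → length L ≡ k → det R k (cols R M L) ≈ Det k (map (column M) L)
  det-cols {zero}  M []  _   = refl
  det-cols {suc k} M L   len = begin
    det R (suc k) (cols R M L)
      ≈⟨ ∑-cong (allFin (suc k)) (λ j → *-congˡ (minor j)) ⟩
    ∑ (map (λ j → sgn (toℕ j) * cols R M L zero j * Det k (map tail (map (column M) (remove L (toℕ j))))) (allFin (suc k)))
      ≈⟨ laplace 0 (Det k ∘ map tail) (column M) L (suc k) len ⟨
    Det (suc k) (map (column M) L) ∎
    where
    minor : ∀ j → det R k (λ i j′ → cols R M L (suc i) (punchIn j j′)) ≈ Det k (map tail (map (column M) (remove L (toℕ j))))
    minor j = begin
      det R k (λ i j′ → cols R M L (suc i) (punchIn j j′))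
        ≈⟨ det-cong k (λ i j′ → reflexive (≡.cong (maybe (M (suc i)) 0#) (nth-punchIn L j j′))) ⟩
      det R k (cols R (M ∘ suc) (remove L (toℕ j)))
        ≈⟨ det-cols (M ∘ suc) (remove L (toℕ j))
             (ℕₚ.suc-injective (≡.trans (length-remove L (≡.subst (toℕ j <_) (≡.sym len) (toℕ<n j))) len)) ⟩
      Det k (map (column (M ∘ suc)) (remove L (toℕ j)))
        ≡⟨ ≡.cong (Det k) (map-∘ (remove L (toℕ j))) ⟩
      Det k (map tail (map (column M) (remove L (toℕ j)))) ∎

  module _ {a} {X : Set a} where

    select : ∀ {n} → (Fin n → X) → Subset n → List X
    select d []            = []
    select d (outside ∷ S) = select (d ∘ suc) S
    select d (inside ∷ S)  = d zero ∷ select (d ∘ suc) S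

    length-select : ∀ {n} (d : Fin n → X) S → length (select d S) ≡ ∣ S ∣
    length-select d []            = ≡.refl
    length-select d (outside ∷ S) = length-select (d ∘ suc) S
    length-select d (inside ∷ S)  = ≡.cong suc (length-select (d ∘ suc) S)

    map-elems : ∀ {n} (d : Fin n → X) S → map d (elems S) ≡ select d S
    map-elems d []            = ≡.refl
    map-elems d (outside ∷ S) = ≡.trans (≡.sym (map-∘ (elems S))) (map-elems (d ∘ suc) S)
    map-elems d (inside ∷ S)  = ≡.cong (d zero ∷_) (≡.trans (≡.sym (map-∘ (elems S))) (map-elems (d ∘ suc) S))

    select-∈ : ∀ {n} (d : Fin n → X) {S j} → j ∈ S → ∃₂ λ P Q → select d S ≡ P ++ d j ∷ Q
    select-∈ d               here        = [] , _ , ≡.refl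
    select-∈ d {outside ∷ S} (there j∈S) = select-∈ (d ∘ suc) j∈S
    select-∈ d {inside ∷ S}  (there j∈S) with P , Q , eq ← select-∈ (d ∘ suc) j∈S = d zero ∷ P , Q , ≡.cong (d zero ∷_) eq

    -- The positions of S in increasing order, those in G filled from ys and
    -- the others from xs; a position whose list has run out is skipped.
    merge : ∀ {n} → Subset n → Subset n → List X → List X → List X
    merge []            []            xs       ys       = []
    merge (outside ∷ S) (_ ∷ G)       xs       ys       = merge S G xs ys
    merge (inside ∷ S)  (outside ∷ G) []       ys       = merge S G [] ys
    merge (inside ∷ S)  (outside ∷ G) (x ∷ xs) ys       = x ∷ merge S G xs ys
    merge (inside ∷ S)  (inside ∷ G)  xs       []       = merge S G xs []
    merge (inside ∷ S)  (inside ∷ G)  xs       (y ∷ ys) = y ∷ merge S G xs ys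

    merge-─ : ∀ {n} (S G : Subset n) xs ys → merge S G xs ys ≡ merge S (S ─ G) ys xs
    merge-─ []            []            xs       ys       = ≡.refl
    merge-─ (outside ∷ S) (outside ∷ G) xs       ys       = merge-─ S G xs ys
    merge-─ (outside ∷ S) (inside ∷ G)  xs       ys       = merge-─ S G xs ys
    merge-─ (inside ∷ S)  (outside ∷ G) []       ys       = merge-─ S G [] ys
    merge-─ (inside ∷ S)  (outside ∷ G) (x ∷ xs) ys       = ≡.cong (x ∷_) (merge-─ S G xs ys)
    merge-─ (inside ∷ S)  (inside ∷ G)  xs       []       = merge-─ S G xs []
    merge-─ (inside ∷ S)  (inside ∷ G)  xs       (y ∷ ys) = ≡.cong (y ∷_) (merge-─ S G xs ys)

  map-select : ∀ {a b} {X : Set a} {Y : Set b} (f : X → Y) {n} (d : Fin n → X) S → map f (select d S) ≡ select (f ∘ d) S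
  map-select f d []            = ≡.refl
  map-select f d (outside ∷ S) = map-select f (d ∘ suc) S
  map-select f d (inside ∷ S)  = ≡.cong (f (d zero) ∷_) (map-select f (d ∘ suc) S)

  map-merge : ∀ {a b} {X : Set a} {Y : Set b} (f : X → Y) {n} (S G : Subset n) xs ys →
              map f (merge S G xs ys) ≡ merge S G (map f xs) (map f ys)
  map-merge f []            []            xs       ys       = ≡.refl
  map-merge f (outside ∷ S) (_ ∷ G)       xs       ys       = map-merge f S G xs ys
  map-merge f (inside ∷ S)  (outside ∷ G) []       ys       = map-merge f S G [] ys
  map-merge f (inside ∷ S)  (outside ∷ G) (x ∷ xs) ys       = ≡.cong (f x ∷_) (map-merge f S G xs ys)
  map-merge f (inside ∷ S)  (inside ∷ G)  xs       []       = map-merge f S G xs []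
  map-merge f (inside ∷ S)  (inside ∷ G)  xs       (y ∷ ys) = ≡.cong (f y ∷_) (map-merge f S G xs ys)

  -- The number of adjacent transpositions that move the entries at the
  -- positions of S ─ G in front of those at the positions of G and of j
  -- further entries placed before them.
  inversions : ∀ {n} → ℕ → Subset n → Subset n → ℕ
  inversions j []            []            = 0
  inversions j (outside ∷ S) (_ ∷ G)       = inversions j S G
  inversions j (inside ∷ S)  (outside ∷ G) = j ℕ.+ inversions j S G
  inversions j (inside ∷ S)  (inside ∷ G)  = inversions (suc j) S G

  inversions-+ : ∀ {n} i j (S G : Subset n) → inversions (i ℕ.+ j) S G ≡ i ℕ.* ∣ S ─ G ∣ ℕ.+ inversions j S G
  inversions-+ i j []            []            = ≡.cong (ℕ._+ 0) (≡.sym (ℕₚ.*-zeroʳ i))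
  inversions-+ i j (outside ∷ S) (outside ∷ G) = inversions-+ i j S G
  inversions-+ i j (outside ∷ S) (inside ∷ G)  = inversions-+ i j S G
  inversions-+ i j (inside ∷ S)  (outside ∷ G) =
    ≡.trans (≡.cong ((i ℕ.+ j) ℕ.+_) (inversions-+ i j S G)) (rearrange i j ∣ S ─ G ∣ (inversions j S G))
    where
    rearrange : ∀ i j m v → (i ℕ.+ j) ℕ.+ (i ℕ.* m ℕ.+ v) ≡ i ℕ.* suc m ℕ.+ (j ℕ.+ v)
    rearrange = solve-∀
  inversions-+ i j (inside ∷ S)  (inside ∷ G)  =
    ≡.trans (≡.cong (λ j′ → inversions j′ S G) (≡.sym (ℕₚ.+-suc i j))) (inversions-+ i (suc j) S G)

  merge-sign : ∀ {k n} {φ : Form k} → IsAlternating φ → (S G : Subset n) → G ⊆ S → ∀ xs ys zs →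
               length xs ≡ ∣ S ─ G ∣ → length ys ≡ ∣ G ∣ →
               φ (zs ++ merge S G xs ys) ≈ sgn (inversions (length zs) S G) * φ (xs ++ zs ++ ys)
  merge-sign         alt []            []            G⊆S [] [] zs _ _ = sym (*-identityˡ _)
  merge-sign         alt (outside ∷ S) (outside ∷ G) G⊆S xs ys zs ∣xs∣ ∣ys∣ =
    merge-sign alt S G (drop-∷-⊆ G⊆S) xs ys zs ∣xs∣ ∣ys∣
  merge-sign         alt (outside ∷ S) (inside ∷ G)  G⊆S xs ys zs ∣xs∣ ∣ys∣ with () ← G⊆S here
  merge-sign {φ = φ} alt (inside ∷ S)  (outside ∷ G) G⊆S (x ∷ xs) ys zs ∣xs∣ ∣ys∣ = begin
    φ (zs ++ x ∷ merge S G xs ys)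
      ≈⟨ move alt zs x (merge S G xs ys) ⟩
    sgn (length zs) * φ (x ∷ zs ++ merge S G xs ys)
      ≈⟨ *-congˡ (merge-sign (∷-isAlternating alt x) S G (drop-∷-⊆ G⊆S) xs ys zs (ℕₚ.suc-injective ∣xs∣) ∣ys∣) ⟩
    sgn (length zs) * (sgn (inversions (length zs) S G) * φ (x ∷ xs ++ zs ++ ys))
      ≈⟨ trans (sym (*-assoc _ _ _)) (*-congʳ (sym (sgn-+ (length zs) _))) ⟩
    sgn (length zs ℕ.+ inversions (length zs) S G) * φ (x ∷ xs ++ zs ++ ys) ∎
  merge-sign {φ = φ} alt (inside ∷ S)  (inside ∷ G)  G⊆S xs (y ∷ ys) zs ∣xs∣ ∣ys∣ = begin
    φ (zs ++ y ∷ merge S G xs ys)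
      ≡⟨ ≡.cong φ (++-assoc zs (y ∷ []) _) ⟨
    φ ((zs ++ y ∷ []) ++ merge S G xs ys)
      ≈⟨ merge-sign alt S G (drop-∷-⊆ G⊆S) xs ys (zs ++ y ∷ []) ∣xs∣ (ℕₚ.suc-injective ∣ys∣) ⟩
    sgn (inversions (length (zs ++ y ∷ [])) S G) * φ (xs ++ (zs ++ y ∷ []) ++ ys)
      ≡⟨ ≡.cong₂ (λ m L → sgn (inversions m S G) * φ (xs ++ L)) (length-∷ʳ zs y) (++-assoc zs (y ∷ []) ys) ⟩
    sgn (inversions (suc (length zs)) S G) * φ (xs ++ zs ++ y ∷ ys) ∎

  ─-involutive : ∀ {n} {S V : Subset n} → V ⊆ S → S ─ (S ─ V) ≡ V
  ─-involutive {S = []}          {[]}          _   = ≡.refl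
  ─-involutive {S = outside ∷ S} {outside ∷ V} V⊆S = ≡.cong (outside ∷_) (─-involutive (drop-∷-⊆ V⊆S))
  ─-involutive {S = outside ∷ S} {inside ∷ V}  V⊆S with () ← V⊆S here
  ─-involutive {S = inside ∷ S}  {outside ∷ V} V⊆S = ≡.cong (outside ∷_) (─-involutive (drop-∷-⊆ V⊆S))
  ─-involutive {S = inside ∷ S}  {inside ∷ V}  V⊆S = ≡.cong (inside ∷_) (─-involutive (drop-∷-⊆ V⊆S))

  ∣─∣+∣∣ : ∀ {n} {S G : Subset n} → G ⊆ S → ∣ S ─ G ∣ ℕ.+ ∣ G ∣ ≡ ∣ S ∣
  ∣─∣+∣∣ {S = []}          {[]}          _   = ≡.refl
  ∣─∣+∣∣ {S = outside ∷ S} {outside ∷ G} G⊆S = ∣─∣+∣∣ (drop-∷-⊆ G⊆S)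
  ∣─∣+∣∣ {S = outside ∷ S} {inside ∷ G}  G⊆S with () ← G⊆S here
  ∣─∣+∣∣ {S = inside ∷ S}  {outside ∷ G} G⊆S = ≡.cong suc (∣─∣+∣∣ (drop-∷-⊆ G⊆S))
  ∣─∣+∣∣ {S = inside ∷ S}  {inside ∷ G}  G⊆S = ≡.trans (ℕₚ.+-suc _ _) (≡.cong suc (∣─∣+∣∣ (drop-∷-⊆ G⊆S)))

  ∈─⇒∉ : ∀ {n} {x : Fin n} {p q} → x ∈ p ─ q → x ∉ q
  ∈─⇒∉ {p = _ ∷ p} {inside ∷ q}  ()          here
  ∈─⇒∉ {p = _ ∷ p} {outside ∷ q} here        ()
  ∈─⇒∉ {p = _ ∷ p} {_ ∷ q}       (there x∈) (there x∈q) = ∈─⇒∉ x∈ x∈q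

  ⊈⇒∃ : ∀ {n} {p q : Subset n} → ¬ (p ⊆ q) → ∃ λ x → x ∈ p × x ∉ q
  ⊈⇒∃ {n} {p} {q} p⊈q
    with x , ¬[x∈p⇒x∈q] ← ¬∀⟶∃¬ n _ (λ x → (x ∈? p) →-dec (x ∈? q)) (λ p⊆q → p⊈q (p⊆q _))
    with x ∈? p
  ... | yes x∈p = x , x∈p , λ x∈q → ¬[x∈p⇒x∈q] (λ _ → x∈q)
  ... | no  x∉p = contradiction (λ x∈p → contradiction x∈p x∉p) ¬[x∈p⇒x∈q]

  module _ {a} {X : Set a} where

    -- assoc with its default value separated from the key, so that the keys
    -- can be shifted by suc.
    lookupOr : ∀ {n} → List (Fin n × X) → X → Fin n → X
    lookupOr []             x j = x
    lookupOr ((i , y) ∷ ps) x j = if does (i ≟ j) then y else lookupOr ps x j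

    lookupOr-zero : ∀ {n} (is : List (Fin n)) ys x → lookupOr (zip (map suc is) ys) x zero ≡ x
    lookupOr-zero []       ys       x = ≡.refl
    lookupOr-zero (i ∷ is) []       x = ≡.refl
    lookupOr-zero (i ∷ is) (y ∷ ys) x = lookupOr-zero is ys x

    lookupOr-suc : ∀ {n} (is : List (Fin n)) ys x j → lookupOr (zip (map suc is) ys) x (suc j) ≡ lookupOr (zip is ys) x j
    lookupOr-suc []       ys       x j = ≡.refl
    lookupOr-suc (i ∷ is) []       x j = ≡.refl
    lookupOr-suc (i ∷ is) (y ∷ ys) x j with does (i ≟ j)
    ... | true  = ≡.refl
    ... | false = lookupOr-suc is ys x j

    lookupOr-map-suc : ∀ {n} ps (is : List (Fin n)) ys (d : Fin (suc n) → X) L →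
                       (∀ x j → lookupOr ps x (suc j) ≡ lookupOr (zip is ys) x j) →
                       map (λ j → lookupOr ps (d j) j) (map suc L) ≡ map (λ j → lookupOr (zip is ys) (d (suc j)) j) L
    lookupOr-map-suc ps is ys d L step = ≡.trans (≡.sym (map-∘ L)) (map-cong (λ j → step (d (suc j)) j) L)

    lookupOr-elems : ∀ {n} (d : Fin n → X) (S G : Subset n) ys → G ⊆ S → length ys ≡ ∣ G ∣ →
                     map (λ j → lookupOr (zip (elems G) ys) (d j) j) (elems S) ≡ merge S G (select d (S ─ G)) ys
    lookupOr-elems d []            []            []       _   _    = ≡.refl
    lookupOr-elems d (outside ∷ S) (outside ∷ G) ys       G⊆S ∣ys∣ =
      ≡.trans (lookupOr-map-suc (zip (map suc (elems G)) ys) (elems G) ys d (elems S) (lookupOr-suc (elems G) ys))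
              (lookupOr-elems (d ∘ suc) S G ys (drop-∷-⊆ G⊆S) ∣ys∣)
    lookupOr-elems d (outside ∷ S) (inside ∷ G)  ys       G⊆S ∣ys∣ with () ← G⊆S here
    lookupOr-elems d (inside ∷ S)  (outside ∷ G) ys       G⊆S ∣ys∣ =
      ≡.cong₂ _∷_ (lookupOr-zero (elems G) ys (d zero))
        (≡.trans (lookupOr-map-suc (zip (map suc (elems G)) ys) (elems G) ys d (elems S) (lookupOr-suc (elems G) ys))
                 (lookupOr-elems (d ∘ suc) S G ys (drop-∷-⊆ G⊆S) ∣ys∣))
    lookupOr-elems d (inside ∷ S)  (inside ∷ G)  (y ∷ ys) G⊆S ∣ys∣ =
      ≡.cong (y ∷_) (≡.trans (lookupOr-map-suc ((zero , y) ∷ zip (map suc (elems G)) ys) (elems G) ys d (elems S)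
                                               (lookupOr-suc (elems G) ys))
                             (lookupOr-elems (d ∘ suc) S G ys (drop-∷-⊆ G⊆S) (ℕₚ.suc-injective ∣ys∣)))

  assoc≡lookupOr : ∀ {n} (ps : List (Fin n × Fin n)) j → assoc ps j ≡ lookupOr ps j j
  assoc≡lookupOr []             j = ≡.refl
  assoc≡lookupOr ((i , y) ∷ ps) j with does (i ≟ j)
  ... | true  = ≡.refl
  ... | false = assoc≡lookupOr ps j

  elems≡select : ∀ {n} (S : Subset n) → elems S ≡ select (λ j → j) S
  elems≡select S = ≡.trans (≡.sym (map-id (elems S))) (map-elems (λ j → j) S)

  det-replace : ∀ {k n} (M : Fin k → Fin n → Carrier) (S G : Subset n) xs → G ⊆ S → ∣ S ∣ ≡ k → length xs ≡ ∣ G ∣ →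
                det R k (cols R M (map (assoc (zip (elems G) xs)) (elems S))) ≈
                Det k (merge S G (select (column M) (S ─ G)) (map (column M) xs))
  det-replace {k} M S G xs G⊆S ∣S∣≡k ∣xs∣ = begin
    det R k (cols R M (map (assoc (zip (elems G) xs)) (elems S)))
      ≈⟨ det-cols M _ (≡.trans (length-map _ (elems S))
                               (≡.trans (≡.cong length (elems≡select S)) (≡.trans (length-select _ S) ∣S∣≡k))) ⟩
    Det k (map (column M) (map (assoc (zip (elems G) xs)) (elems S)))
      ≡⟨ ≡.cong (Det k ∘ map (column M)) (≡.trans (map-cong (assoc≡lookupOr (zip (elems G) xs)) (elems S))
                                                 (lookupOr-elems (λ j → j) S G xs G⊆S ∣xs∣)) ⟩
    Det k (map (column M) (merge S G (select (λ j → j) (S ─ G)) xs))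
      ≡⟨ ≡.cong (Det k) (≡.trans (map-merge (column M) S G _ xs)
                                 (≡.cong (λ L → merge S G L (map (column M) xs)) (map-select (column M) (λ j → j) (S ─ G)))) ⟩
    Det k (merge S G (select (column M) (S ─ G)) (map (column M) xs)) ∎

  ∑-between : ∀ {n} → Subset n → Subset n → (Subset n → Carrier) → Carrier
  ∑-between []            []            f = f []
  ∑-between (outside ∷ L) (outside ∷ S) f = ∑-between L S (f ∘ (outside ∷_))
  ∑-between (outside ∷ L) (inside ∷ S)  f = ∑-between L S (f ∘ (outside ∷_)) + ∑-between L S (f ∘ (inside ∷_))
  ∑-between (inside ∷ L)  (outside ∷ S) f = 0#
  ∑-between (inside ∷ L)  (inside ∷ S)  f = ∑-between L S (f ∘ (inside ∷_))

  syntax ∑-between L S (λ V → e) = ∑[ L ⊆ V ⊆ S ] e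

  ∑-between-cong : ∀ {n} (L S : Subset n) {f g : Subset n → Carrier} → (∀ V → L ⊆ V → V ⊆ S → f V ≈ g V) →
                   ∑-between L S f ≈ ∑-between L S g
  ∑-between-cong []            []            f≈g = f≈g [] (λ ()) (λ ())
  ∑-between-cong (outside ∷ L) (outside ∷ S) f≈g = ∑-between-cong L S (λ V L⊆V V⊆S → f≈g _ (out⊆ L⊆V) (out⊆ V⊆S))
  ∑-between-cong (outside ∷ L) (inside ∷ S)  f≈g =
    +-cong (∑-between-cong L S (λ V L⊆V V⊆S → f≈g _ (out⊆ L⊆V) (out⊆ V⊆S)))
           (∑-between-cong L S (λ V L⊆V V⊆S → f≈g _ (out⊆ L⊆V) (in⊆in V⊆S)))
  ∑-between-cong (inside ∷ L)  (outside ∷ S) f≈g = refl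
  ∑-between-cong (inside ∷ L)  (inside ∷ S)  f≈g = ∑-between-cong L S (λ V L⊆V V⊆S → f≈g _ (in⊆in L⊆V) (in⊆in V⊆S))

  ∑-between-*ˡ : ∀ {n} (L S : Subset n) a (f : Subset n → Carrier) → ∑[ L ⊆ V ⊆ S ] (a * f V) ≈ a * ∑-between L S f
  ∑-between-*ˡ []            []            a f = refl
  ∑-between-*ˡ (outside ∷ L) (outside ∷ S) a f = ∑-between-*ˡ L S a _
  ∑-between-*ˡ (outside ∷ L) (inside ∷ S)  a f =
    trans (+-cong (∑-between-*ˡ L S a _) (∑-between-*ˡ L S a _)) (sym (distribˡ a _ _))
  ∑-between-*ˡ (inside ∷ L)  (outside ∷ S) a f = sym (zeroʳ a)
  ∑-between-*ˡ (inside ∷ L)  (inside ∷ S)  a f = ∑-between-*ˡ L S a _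

  ∑-between-sgn : ∀ {n} (L S : Subset n) j (e : Subset n → ℕ) (f : Subset n → Carrier) →
                  sgn j * ∑[ L ⊆ V ⊆ S ] (sgn (e V) * f V) ≈ ∑[ L ⊆ V ⊆ S ] (sgn (j ℕ.+ e V) * f V)
  ∑-between-sgn L S j e f = trans (sym (∑-between-*ˡ L S (sgn j) (λ V → sgn (e V) * f V)))
    (∑-between-cong L S (λ V _ _ → trans (sym (*-assoc _ _ _)) (*-congʳ (sym (sgn-+ j (e V))))))

  ∑-between-complement : ∀ {n} (L S : Subset n) → L ⊆ S → ∀ (f : Subset n → Carrier) →
                         ∑-between ⊥ (S ─ L) f ≈ ∑[ L ⊆ V ⊆ S ] f (S ─ V)
  ∑-between-complement []            []            L⊆S f = refl
  ∑-between-complement (outside ∷ L) (outside ∷ S) L⊆S f = ∑-between-complement L S (drop-∷-⊆ L⊆S) _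
  ∑-between-complement (outside ∷ L) (inside ∷ S)  L⊆S f =
    trans (+-comm _ _) (+-cong (∑-between-complement L S (drop-∷-⊆ L⊆S) _) (∑-between-complement L S (drop-∷-⊆ L⊆S) _))
  ∑-between-complement (inside ∷ L)  (outside ∷ S) L⊆S f with () ← L⊆S here
  ∑-between-complement (inside ∷ L)  (inside ∷ S)  L⊆S f = ∑-between-complement L S (drop-∷-⊆ L⊆S) _

  in⊈out : ∀ {n} {p q : Subset n} → ¬ (inside ∷ p ⊆ outside ∷ q)
  in⊈out p⊆q with () ← p⊆q here

  drop-both : ∀ {n} {x y z} {L V S : Subset n} → x ∷ L ⊆ y ∷ V × y ∷ V ⊆ z ∷ S → L ⊆ V × V ⊆ S
  drop-both (L⊆V , V⊆S) = drop-∷-⊆ L⊆V , drop-∷-⊆ V⊆S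

  ∑-subsets : ∀ n → (Subset n → Carrier) → Carrier
  ∑-subsets n f = ∑ (map f (subsets n))

  ∑-subsets-suc : ∀ n (f : Subset (suc n) → Carrier) →
                  ∑-subsets (suc n) f ≈ ∑-subsets n (f ∘ (outside ∷_)) + ∑-subsets n (f ∘ (inside ∷_))
  ∑-subsets-suc n f = begin
    ∑ (map f (map (outside ∷_) (subsets n) ++ map (inside ∷_) (subsets n)))
      ≡⟨ ≡.cong ∑ (map-++ f (map (outside ∷_) (subsets n)) _) ⟩
    ∑ (map f (map (outside ∷_) (subsets n)) ++ map f (map (inside ∷_) (subsets n)))
      ≈⟨ ∑-++ (map f (map (outside ∷_) (subsets n))) _ ⟩
    ∑ (map f (map (outside ∷_) (subsets n))) + ∑ (map f (map (inside ∷_) (subsets n)))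
      ≡⟨ ≡.cong₂ (λ xs ys → ∑ xs + ∑ ys) (map-∘ (subsets n)) (map-∘ (subsets n)) ⟨
    ∑-subsets n (f ∘ (outside ∷_)) + ∑-subsets n (f ∘ (inside ∷_)) ∎

  ∑-subsets-between : ∀ {n} (L S : Subset n) (f : Subset n → Carrier) → (∀ V → ¬ (L ⊆ V × V ⊆ S) → f V ≈ 0#) →
                      ∑-subsets n f ≈ ∑-between L S f
  ∑-subsets-between         []            []            f f≈0 = +-identityʳ _
  ∑-subsets-between {suc n} (outside ∷ L) (outside ∷ S) f f≈0 = begin
    ∑-subsets (suc n) f                                            ≈⟨ ∑-subsets-suc n f ⟩
    ∑-subsets n (f ∘ (outside ∷_)) + ∑-subsets n (f ∘ (inside ∷_))
      ≈⟨ +-cong (∑-subsets-between L S _ (λ V ∉ → f≈0 _ (∉ ∘ drop-both)))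
                (∑-zero (subsets n) (λ V → f≈0 _ (λ (_ , V⊆S) → in⊈out V⊆S))) ⟩
    ∑-between L S (f ∘ (outside ∷_)) + 0#                          ≈⟨ +-identityʳ _ ⟩
    ∑-between L S (f ∘ (outside ∷_))                               ∎
  ∑-subsets-between {suc n} (outside ∷ L) (inside ∷ S)  f f≈0 = trans (∑-subsets-suc n f)
    (+-cong (∑-subsets-between L S _ (λ V ∉ → f≈0 _ (∉ ∘ drop-both)))
            (∑-subsets-between L S _ (λ V ∉ → f≈0 _ (∉ ∘ drop-both))))
  ∑-subsets-between {suc n} (inside ∷ L)  (outside ∷ S) f f≈0 = trans (∑-subsets-suc n f)
    (trans (+-cong (∑-zero (subsets n) (λ V → f≈0 _ (λ (L⊆V , _) → in⊈out L⊆V)))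
                   (∑-zero (subsets n) (λ V → f≈0 _ (λ (_ , V⊆S) → in⊈out V⊆S))))
           (+-identityʳ 0#))
  ∑-subsets-between {suc n} (inside ∷ L)  (inside ∷ S)  f f≈0 = begin
    ∑-subsets (suc n) f                                            ≈⟨ ∑-subsets-suc n f ⟩
    ∑-subsets n (f ∘ (outside ∷_)) + ∑-subsets n (f ∘ (inside ∷_))
      ≈⟨ +-cong (∑-zero (subsets n) (λ V → f≈0 _ (λ (L⊆V , _) → in⊈out L⊆V)))
                (∑-subsets-between L S _ (λ V ∉ → f≈0 _ (∉ ∘ drop-both))) ⟩
    0# + ∑-between L S (f ∘ (inside ∷_))                           ≈⟨ +-identityˡ _ ⟩
    ∑-between L S (f ∘ (inside ∷_))                                ∎

  entries : ∀ {k n} → (Fin n → Vector Carrier k) → Subset n → Subset n → List (Entry k)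
  entries d []            []            = []
  entries d (outside ∷ S) (_ ∷ F)       = entries (d ∘ suc) S F
  entries d (inside ∷ S)  (outside ∷ F) = fixed (d zero) ∷ entries (d ∘ suc) S F
  entries d (inside ∷ S)  (inside ∷ F)  = free (d zero) ∷ entries (d ∘ suc) S F

  free-entries-entries : ∀ {k n} (d : Fin n → Vector Carrier k) S F → F ⊆ S → free-entries (entries d S F) ≡ ∣ F ∣
  free-entries-entries d []            []            F⊆S = ≡.refl
  free-entries-entries d (outside ∷ S) (outside ∷ F) F⊆S = free-entries-entries (d ∘ suc) S F (drop-∷-⊆ F⊆S)
  free-entries-entries d (outside ∷ S) (inside ∷ F)  F⊆S with () ← F⊆S here
  free-entries-entries d (inside ∷ S)  (outside ∷ F) F⊆S = free-entries-entries (d ∘ suc) S F (drop-∷-⊆ F⊆S)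
  free-entries-entries d (inside ∷ S)  (inside ∷ F)  F⊆S = ≡.cong suc (free-entries-entries (d ∘ suc) S F (drop-∷-⊆ F⊆S))

  expand : ∀ {k n} (d : Fin n → Vector Carrier k) (S F : Subset n) → F ⊆ S → ∀ j (φ ψ : Form k) E →
           shuffle j φ ψ (entries d S F ++ E) ≈
           ∑[ ⊥ ⊆ G ⊆ F ] (sgn (inversions j S G) *
                           shuffle (∣ G ∣ ℕ.+ j) (φ ∘ (select d (S ─ G) ++_)) (ψ ∘ (select d G ++_)) E)
  expand d []            []            F⊆S j φ ψ E = sym (*-identityˡ _)
  expand d (outside ∷ S) (outside ∷ F) F⊆S j φ ψ E = expand (d ∘ suc) S F (drop-∷-⊆ F⊆S) j φ ψ E
  expand d (outside ∷ S) (inside ∷ F)  F⊆S j φ ψ E with () ← F⊆S here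
  expand d (inside ∷ S)  (outside ∷ F) F⊆S j φ ψ E =
    trans (*-congˡ (expand (d ∘ suc) S F (drop-∷-⊆ F⊆S) j (φ ∘ (d zero ∷_)) ψ E))
          (∑-between-sgn ⊥ F j (inversions j S) to-φ)
    where
    to-φ : Subset _ → Carrier
    to-φ G = shuffle (∣ G ∣ ℕ.+ j) (φ ∘ (d zero ∷_) ∘ (select (d ∘ suc) (S ─ G) ++_)) (ψ ∘ (select (d ∘ suc) G ++_)) E
  expand d (inside ∷ S)  (inside ∷ F)  F⊆S j φ ψ E = +-cong
    (trans (*-congˡ (expand (d ∘ suc) S F (drop-∷-⊆ F⊆S) j (φ ∘ (d zero ∷_)) ψ E))
           (∑-between-sgn ⊥ F j (inversions j S) to-φ))
    (trans (expand (d ∘ suc) S F (drop-∷-⊆ F⊆S) (suc j) φ (ψ ∘ (d zero ∷_)) E)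
           (∑-between-cong ⊥ F (λ G _ _ → *-congˡ (reflexive (≡.cong (to-ψ G) (ℕₚ.+-suc ∣ G ∣ j))))))
    where
    to-φ : Subset _ → Carrier
    to-φ G = shuffle (∣ G ∣ ℕ.+ j) (φ ∘ (d zero ∷_) ∘ (select (d ∘ suc) (S ─ G) ++_)) (ψ ∘ (select (d ∘ suc) G ++_)) E
    to-ψ : Subset _ → ℕ → Carrier
    to-ψ G i = shuffle i (φ ∘ (select (d ∘ suc) (S ─ G) ++_)) (ψ ∘ (d zero ∷_) ∘ (select (d ∘ suc) G ++_)) E

  expand-[] : ∀ {k n} (d : Fin n → Vector Carrier k) (S F : Subset n) → F ⊆ S → ∀ j (φ ψ : Form k) →
              shuffle j φ ψ (entries d S F) ≈ ∑[ ⊥ ⊆ G ⊆ F ] (sgn (inversions j S G) * (φ (select d (S ─ G)) * ψ (select d G)))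
  expand-[] d S F F⊆S j φ ψ = begin
    shuffle j φ ψ (entries d S F)       ≡⟨ ≡.cong (shuffle j φ ψ) (++-identityʳ (entries d S F)) ⟨
    shuffle j φ ψ (entries d S F ++ []) ≈⟨ expand d S F F⊆S j φ ψ [] ⟩
    ∑[ ⊥ ⊆ G ⊆ F ] (sgn (inversions j S G) * (φ (select d (S ─ G) ++ []) * ψ (select d G ++ [])))
      ≈⟨ ∑-between-cong ⊥ F (λ G _ _ → *-congˡ (reflexive
           (≡.cong₂ (λ x y → φ x * ψ y) (++-identityʳ _) (++-identityʳ _)))) ⟩
    ∑[ ⊥ ⊆ G ⊆ F ] (sgn (inversions j S G) * (φ (select d (S ─ G)) * ψ (select d G))) ∎

  module Lemma5p4 {r n} (M : Fin r → Fin n → Carrier) (A B X Y : Subset n)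
                  (∣A∣≡r : ∣ A ∣ ≡ r) (∣B∣≡r : ∣ B ∣ ≡ r) (X⊆A─B : X ⊆ A ─ B) (Y⊆B─A : Y ⊆ B ─ A) where

    X⊆A : X ⊆ A
    X⊆A = ⊆-trans X⊆A─B (p─q⊆p A B)

    Y⊆B : Y ⊆ B
    Y⊆B = ⊆-trans Y⊆B─A (p─q⊆p B A)

    columns : Subset n → List (Vector Carrier r)
    columns = select (column M)

    D : Form r
    D = Det r

    D-alt : IsAlternating D
    D-alt = Det-isAlternating r

    length-elems : ∀ (S : Subset n) → length (elems S) ≡ ∣ S ∣
    length-elems S = ≡.trans (≡.cong length (elems≡select S)) (length-select _ S)

    μ-formula : ∀ U V → U ⊆ A → V ⊆ B → ∣ V ∣ ≡ ∣ U ∣ →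
                μ R M A B U V ≈ (sgn (inversions 0 A U) * D (columns (A ─ U) ++ columns V)) *
                                (sgn (inversions 0 B (B ─ V)) * D (columns U ++ columns (B ─ V)))
    μ-formula U V U⊆A V⊆B ∣V∣≡∣U∣ = *-cong
      (begin
        det R r (cols R M (map (assoc (zip (elems U) (elems V))) (elems A)))
          ≈⟨ det-replace M A U (elems V) U⊆A ∣A∣≡r (≡.trans (length-elems V) ∣V∣≡∣U∣) ⟩
        D (merge A U (columns (A ─ U)) (map (column M) (elems V)))
          ≡⟨ ≡.cong (D ∘ merge A U (columns (A ─ U))) (map-elems (column M) V) ⟩
        D (merge A U (columns (A ─ U)) (columns V))
          ≈⟨ merge-sign D-alt A U U⊆A (columns (A ─ U)) (columns V) [] (length-select _ (A ─ U))
                        (≡.trans (length-select _ V) ∣V∣≡∣U∣) ⟩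
        sgn (inversions 0 A U) * D (columns (A ─ U) ++ columns V) ∎)
      (begin
        det R r (cols R M (map (assoc (zip (elems V) (elems U))) (elems B)))
          ≈⟨ det-replace M B V (elems U) V⊆B ∣B∣≡r (≡.trans (length-elems U) (≡.sym ∣V∣≡∣U∣)) ⟩
        D (merge B V (columns (B ─ V)) (map (column M) (elems U)))
          ≡⟨ ≡.cong D (≡.trans (≡.cong (merge B V (columns (B ─ V))) (map-elems (column M) U)) (merge-─ B V _ _)) ⟩
        D (merge B (B ─ V) (columns U) (columns (B ─ V)))
          ≈⟨ merge-sign D-alt B (B ─ V) (p─q⊆p B V) (columns U) (columns (B ─ V)) []
                        (≡.trans (length-select _ U) (≡.trans (≡.sym ∣V∣≡∣U∣) (≡.cong ∣_∣ (≡.sym (─-involutive V⊆B)))))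
                        (length-select _ (B ─ V)) ⟩
        sgn (inversions 0 B (B ─ V)) * D (columns U ++ columns (B ─ V)) ∎)

    PU : ∀ h (U : Subset n) → Dec (U ⊆ X × ∣ U ∣ ≡ h)
    PU h U = (U ⊆? X) ×-dec (∣ U ∣ ℕ.≟ h)

    PV : ∀ h (V : Subset n) → Dec (V ⊆ B ─ A × ∣ V ∣ ≡ h × Y ⊆ V)
    PV h V = (V ⊆? (B ─ A)) ×-dec ((∣ V ∣ ℕ.≟ h) ×-dec (Y ⊆? V))

    Σμ : ℕ → Subset n → Carrier
    Σμ h U = ∑ (map (μ R M A B U) (filter (PV h) (subsets n)))

    hs : List ℕ
    hs = map (∣ Y ∣ ℕ.+_) (upTo (suc (∣ X ∣ ∸ ∣ Y ∣)))

    statement-term : Subset n → Subset n → Carrier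
    statement-term U V = sgn ∣ U ∣ * (if does (PV ∣ U ∣ V) then μ R M A B U V else 0#)

    lemmaSum-by-subsets : lemmaSum R M A B X Y ≈
                          ∑-subsets n (λ U → ∑ (map (λ h → sgn h * (if does (PU h U) then Σμ h U else 0#)) hs))
    lemmaSum-by-subsets = begin
      lemmaSum R M A B X Y
        ≈⟨ ∑-cong hs (λ h → *-congˡ (∑-filter (PU h) (Σμ h) (subsets n))) ⟩
      ∑ (map (λ h → sgn h * ∑-subsets n (λ U → if does (PU h U) then Σμ h U else 0#)) hs)
        ≈⟨ ∑-cong hs (λ h → sym (∑-*ˡ (sgn h) _ (subsets n))) ⟩
      ∑ (map (λ h → ∑-subsets n (λ U → sgn h * (if does (PU h U) then Σμ h U else 0#))) hs)
        ≈⟨ ∑-swap (λ h U → sgn h * (if does (PU h U) then Σμ h U else 0#)) hs (subsets n) ⟩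
      ∑-subsets n (λ U → ∑ (map (λ h → sgn h * (if does (PU h U) then Σμ h U else 0#)) hs)) ∎

    Σμ-small : ∀ U → ∣ U ∣ < ∣ Y ∣ → Σμ ∣ U ∣ U ≈ 0#
    Σμ-small U ∣U∣<∣Y∣ = trans (∑-filter (PV ∣ U ∣) (μ R M A B U) (subsets n))
      (∑-zero (subsets n) (λ V → if-false (PV ∣ U ∣ V) (λ (_ , ∣V∣≡∣U∣ , Y⊆V) →
        ℕₚ.<⇒≱ ∣U∣<∣Y∣ (ℕₚ.≤-trans (p⊆q⇒∣p∣≤∣q∣ Y⊆V) (ℕₚ.≤-reflexive ∣V∣≡∣U∣)))))

    Σμ-between : ∀ U → Σμ ∣ U ∣ U ≈ ∑[ Y ⊆ V ⊆ B ] (if does (PV ∣ U ∣ V) then μ R M A B U V else 0#)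
    Σμ-between U = trans (∑-filter (PV ∣ U ∣) (μ R M A B U) (subsets n)) (∑-subsets-between Y B _
      (λ V ∉ → if-false (PV ∣ U ∣ V) (λ (V⊆B─A , _ , Y⊆V) → ∉ (Y⊆V , ⊆-trans V⊆B─A (p─q⊆p B A)))))

    collapse : ∀ U → ∑ (map (λ h → sgn h * (if does (PU h U) then Σμ h U else 0#)) hs) ≈
                     (if does (U ⊆? X) then sgn ∣ U ∣ * Σμ ∣ U ∣ U else 0#)
    collapse U with U ⊆? X
    ... | no  _   = ∑-zero hs (λ h → zeroʳ (sgn h))
    ... | yes U⊆X with ∣ Y ∣ ≤? ∣ U ∣
    ...   | no  ∣Y∣≰∣U∣ = trans (∑-zero hs f≈0) (sym (trans (*-congˡ (Σμ-small U (ℕₚ.≰⇒> ∣Y∣≰∣U∣))) (zeroʳ _)))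
      where
      f≈0 : ∀ h → sgn h * (if does (∣ U ∣ ℕ.≟ h) then Σμ h U else 0#) ≈ 0#
      f≈0 h with h ℕ.≟ ∣ U ∣
      ... | yes ≡.refl =
        trans (*-congˡ (trans (if-true (∣ U ∣ ℕ.≟ ∣ U ∣) ≡.refl) (Σμ-small U (ℕₚ.≰⇒> ∣Y∣≰∣U∣)))) (zeroʳ _)
      ... | no  h≢∣U∣  = trans (*-congˡ (if-false (∣ U ∣ ℕ.≟ h) (h≢∣U∣ ∘ ≡.sym))) (zeroʳ _)
    ...   | yes ∣Y∣≤∣U∣ = begin
      ∑ (map f (map (∣ Y ∣ ℕ.+_) (upTo L)))
        ≡⟨ ≡.cong ∑ (≡.trans (≡.sym (map-∘ (upTo L))) (map-upTo _ L)) ⟩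
      ∑ (applyUpTo (f ∘ (∣ Y ∣ ℕ.+_)) L)
        ≈⟨ ∑-applyUpTo-δ _ L (∣ U ∣ ∸ ∣ Y ∣) (ℕ.s≤s (ℕₚ.∸-monoˡ-≤ ∣ Y ∣ (p⊆q⇒∣p∣≤∣q∣ U⊆X))) off ⟩
      f (∣ Y ∣ ℕ.+ (∣ U ∣ ∸ ∣ Y ∣))
        ≡⟨ ≡.cong f (ℕₚ.m+[n∸m]≡n ∣Y∣≤∣U∣) ⟩
      f ∣ U ∣
        ≈⟨ *-congˡ (if-true (∣ U ∣ ℕ.≟ ∣ U ∣) ≡.refl) ⟩
      sgn ∣ U ∣ * Σμ ∣ U ∣ U ∎
      where
      L : ℕ
      L = suc (∣ X ∣ ∸ ∣ Y ∣)
      f : ℕ → Carrier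
      f h = sgn h * (if does (∣ U ∣ ℕ.≟ h) then Σμ h U else 0#)
      off : ∀ i → i ≢ ∣ U ∣ ∸ ∣ Y ∣ → f (∣ Y ∣ ℕ.+ i) ≈ 0#
      off i i≢ = trans (*-congˡ (if-false (∣ U ∣ ℕ.≟ ∣ Y ∣ ℕ.+ i)
                   (λ ∣U∣≡ → i≢ (≡.trans (≡.sym (ℕₚ.m+n∸m≡n ∣ Y ∣ i)) (≡.cong (_∸ ∣ Y ∣) (≡.sym ∣U∣≡))))))
                 (zeroʳ _)

    lemmaSum-between : lemmaSum R M A B X Y ≈
                       ∑[ ⊥ ⊆ U ⊆ X ] ∑[ Y ⊆ V ⊆ B ] statement-term U V
    lemmaSum-between = begin
      lemmaSum R M A B X Y
        ≈⟨ lemmaSum-by-subsets ⟩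
      ∑-subsets n (λ U → ∑ (map (λ h → sgn h * (if does (PU h U) then Σμ h U else 0#)) hs))
        ≈⟨ ∑-cong (subsets n) collapse ⟩
      ∑-subsets n (λ U → if does (U ⊆? X) then sgn ∣ U ∣ * Σμ ∣ U ∣ U else 0#)
        ≈⟨ ∑-subsets-between ⊥ X _ (λ U ∉ → if-false (U ⊆? X) (λ U⊆X → ∉ (⊥⊆ , U⊆X))) ⟩
      ∑[ ⊥ ⊆ U ⊆ X ] (if does (U ⊆? X) then sgn ∣ U ∣ * Σμ ∣ U ∣ U else 0#)
        ≈⟨ ∑-between-cong ⊥ X (λ U _ U⊆X → trans (if-true (U ⊆? X) U⊆X)
                                                   (trans (*-congˡ (Σμ-between U)) (sym (∑-between-*ˡ Y B (sgn ∣ U ∣) _)))) ⟩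
      ∑[ ⊥ ⊆ U ⊆ X ] ∑[ Y ⊆ V ⊆ B ] statement-term U V ∎

    entries-AB : List (Entry r)
    entries-AB = entries (column M) A X ++ entries (column M) B (B ─ Y)

    shuffle-term : Subset n → Subset n → Carrier
    shuffle-term U V = sgn (inversions 0 A U) * (sgn (inversions (∣ U ∣ ℕ.+ 0) B (B ─ V)) *
               (D (columns (A ─ U) ++ columns (B ─ (B ─ V))) * D (columns U ++ columns (B ─ V))))

    shuffle-expansion : shuffle 0 D D entries-AB ≈ ∑[ ⊥ ⊆ U ⊆ X ] ∑[ Y ⊆ V ⊆ B ] shuffle-term U V
    shuffle-expansion = begin
      shuffle 0 D D entries-AB
        ≈⟨ expand (column M) A X X⊆A 0 D D (entries (column M) B (B ─ Y)) ⟩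
      ∑[ ⊥ ⊆ U ⊆ X ] (sgn (inversions 0 A U) *
                      shuffle (∣ U ∣ ℕ.+ 0) (D ∘ (columns (A ─ U) ++_)) (D ∘ (columns U ++_)) (entries (column M) B (B ─ Y)))
        ≈⟨ ∑-between-cong ⊥ X (λ U _ _ → trans (*-congˡ (second-pass U)) (sym (∑-between-*ˡ Y B _ _))) ⟩
      ∑[ ⊥ ⊆ U ⊆ X ] ∑[ Y ⊆ V ⊆ B ] shuffle-term U V ∎
      where
      second-pass : ∀ U →
                    shuffle (∣ U ∣ ℕ.+ 0) (D ∘ (columns (A ─ U) ++_)) (D ∘ (columns U ++_)) (entries (column M) B (B ─ Y)) ≈
                          ∑[ Y ⊆ V ⊆ B ] (sgn (inversions (∣ U ∣ ℕ.+ 0) B (B ─ V)) *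
                                          (D (columns (A ─ U) ++ columns (B ─ (B ─ V))) * D (columns U ++ columns (B ─ V))))
      second-pass U = trans (expand-[] (column M) B (B ─ Y) (p─q⊆p B Y) _ _ _) (∑-between-complement Y B Y⊆B _)

    shuffle-term-normal : ∀ U V → V ⊆ B →
                  shuffle-term U V ≡ sgn (inversions 0 A U) * (sgn (∣ U ∣ ℕ.* ∣ V ∣ ℕ.+ inversions 0 B (B ─ V)) *
                             (D (columns (A ─ U) ++ columns V) * D (columns U ++ columns (B ─ V))))
    shuffle-term-normal U V V⊆B rewrite inversions-+ ∣ U ∣ 0 B (B ─ V) | ─-involutive V⊆B = ≡.refl

    repeated-column : ∀ U V → U ⊆ X → V ⊆ B → ¬ (V ⊆ B ─ A) → D (columns (A ─ U) ++ columns V) ≈ 0#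
    repeated-column U V U⊆X V⊆B V⊈B─A with j , j∈V , j∉B─A ← ⊈⇒∃ V⊈B─A = twice j∈V (in-A─U j∈V j∉B─A)
      where
      in-A─U : ∀ {j} → j ∈ V → j ∉ B ─ A → j ∈ A ─ U
      in-A─U {j} j∈V j∉B─A with j ∈? A
      ... | yes j∈A = x∈p∧x∉q⇒x∈p─q j∈A (λ j∈U → ∈─⇒∉ (X⊆A─B (U⊆X j∈U)) (V⊆B j∈V))
      ... | no  j∉A = contradiction (x∈p∧x∉q⇒x∈p─q (V⊆B j∈V) j∉A) j∉B─A
      twice : ∀ {j} → j ∈ V → j ∈ A ─ U → D (columns (A ─ U) ++ columns V) ≈ 0#
      twice {j} j∈V j∈A─U with P , Q , eq ← select-∈ (column M) j∈A─U | P′ , Q′ , eq′ ← select-∈ (column M) j∈V =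
        trans (reflexive (≡.cong D (≡.trans (≡.cong₂ _++_ eq eq′)
                                            (≡.trans (++-assoc P _ _) (≡.cong (λ L → P ++ column M j ∷ L) (≡.sym (++-assoc Q P′ _)))))))
              (duplicate D-alt P (column M j) (Q ++ P′) Q′)

    left-zero : ∀ {s t x y} → x ≈ 0# → s * (t * (x * y)) ≈ 0#
    left-zero x≈0 = trans (*-congˡ (trans (*-congˡ (trans (*-congʳ x≈0) (zeroˡ _))) (zeroʳ _))) (zeroʳ _)

    right-zero : ∀ {s t x y} → y ≈ 0# → s * (t * (x * y)) ≈ 0#
    right-zero y≈0 = trans (*-congˡ (trans (*-congˡ (trans (*-congˡ y≈0) (zeroʳ _))) (zeroʳ _))) (zeroʳ _)

    shuffle-term≈statement-term : ∀ U → U ⊆ X → ∀ V → Y ⊆ V → V ⊆ B → shuffle-term U V ≈ statement-term U V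
    shuffle-term≈statement-term U U⊆X V Y⊆V V⊆B rewrite shuffle-term-normal U V V⊆B with V ⊆? (B ─ A)
    ... | no V⊈B─A = trans (left-zero (repeated-column U V U⊆X V⊆B V⊈B─A)) (sym (zeroʳ _))
    ... | yes V⊆B─A with ℕₚ.<-cmp ∣ U ∣ ∣ V ∣
    ...   | tri< ∣U∣<∣V∣ _ _ =
      trans (left-zero (vanish D-alt _ (subst₂ _<_ r≡ (≡.sym ∣cols∣) (ℕₚ.+-monoʳ-< ∣ A ─ U ∣ ∣U∣<∣V∣))))
            (sym (trans (*-congˡ (if-false (∣ V ∣ ℕ.≟ ∣ U ∣ ×-dec Y ⊆? V)
                                           (λ (∣V∣≡∣U∣ , _) → ℕₚ.<-irrefl (≡.sym ∣V∣≡∣U∣) ∣U∣<∣V∣)))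
                        (zeroʳ _)))
      where
      r≡ : ∣ A ─ U ∣ ℕ.+ ∣ U ∣ ≡ r
      r≡ = ≡.trans (∣─∣+∣∣ (⊆-trans U⊆X X⊆A)) ∣A∣≡r
      ∣cols∣ : length (columns (A ─ U) ++ columns V) ≡ ∣ A ─ U ∣ ℕ.+ ∣ V ∣
      ∣cols∣ = ≡.trans (length-++ (columns (A ─ U))) (≡.cong₂ ℕ._+_ (length-select _ (A ─ U)) (length-select _ V))
    ...   | tri> _ _ ∣V∣<∣U∣ =
      trans (right-zero (vanish D-alt _ (subst₂ _<_ r≡ (≡.sym ∣cols∣) (ℕₚ.+-monoʳ-< ∣ B ─ V ∣ ∣V∣<∣U∣))))
            (sym (trans (*-congˡ (if-false (∣ V ∣ ℕ.≟ ∣ U ∣ ×-dec Y ⊆? V)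
                                           (λ (∣V∣≡∣U∣ , _) → ℕₚ.<-irrefl ∣V∣≡∣U∣ ∣V∣<∣U∣)))
                        (zeroʳ _)))
      where
      r≡ : ∣ B ─ V ∣ ℕ.+ ∣ V ∣ ≡ r
      r≡ = ≡.trans (∣─∣+∣∣ V⊆B) ∣B∣≡r
      ∣cols∣ : length (columns U ++ columns (B ─ V)) ≡ ∣ B ─ V ∣ ℕ.+ ∣ U ∣
      ∣cols∣ = ≡.trans (length-++ (columns U))
                       (≡.trans (≡.cong₂ ℕ._+_ (length-select _ U) (length-select _ (B ─ V))) (ℕₚ.+-comm ∣ U ∣ _))
    ...   | tri≈ _ ∣U∣≡∣V∣ _ = begin
      sgn a * (sgn (∣ U ∣ ℕ.* ∣ V ∣ ℕ.+ b) * (D₁ * D₂))     ≈⟨ *-congˡ (*-congʳ (sgn-+ (∣ U ∣ ℕ.* ∣ V ∣) b)) ⟩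
      sgn a * (sgn (∣ U ∣ ℕ.* ∣ V ∣) * sgn b * (D₁ * D₂))  ≈⟨ *-congˡ (*-congʳ (*-congʳ (trans
                                                                (reflexive (≡.cong (λ m → sgn (∣ U ∣ ℕ.* m)) (≡.sym ∣U∣≡∣V∣)))
                                                                (sgn[m*m]≈sgn[m] ∣ U ∣)))) ⟩
      sgn a * (sgn ∣ U ∣ * sgn b * (D₁ * D₂))              ≈⟨ solve 5 (λ a u b x y → a :* (u :* b :* (x :* y))
                                                                                   := u :* ((a :* x) :* (b :* y)))
                                                                 refl (sgn a) (sgn ∣ U ∣) (sgn b) D₁ D₂ ⟩
      sgn ∣ U ∣ * ((sgn a * D₁) * (sgn b * D₂))            ≈⟨ *-congˡ (μ-formula U V (⊆-trans U⊆X X⊆A) V⊆B (≡.sym ∣U∣≡∣V∣)) ⟨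
      sgn ∣ U ∣ * μ R M A B U V                            ≈⟨ *-congˡ (if-true (∣ V ∣ ℕ.≟ ∣ U ∣ ×-dec Y ⊆? V) (≡.sym ∣U∣≡∣V∣ , Y⊆V)) ⟨
      sgn ∣ U ∣ * (if does (∣ V ∣ ℕ.≟ ∣ U ∣ ×-dec Y ⊆? V) then μ R M A B U V else 0#) ∎
      where
      a b : ℕ
      a = inversions 0 A U
      b = inversions 0 B (B ─ V)
      D₁ D₂ : Carrier
      D₁ = D (columns (A ─ U) ++ columns V)
      D₂ = D (columns U ++ columns (B ─ V))

    lemmaSum≈0 : ∣ Y ∣ < ∣ X ∣ → lemmaSum R M A B X Y ≈ 0#
    lemmaSum≈0 ∣Y∣<∣X∣ = begin
      lemmaSum R M A B X Y
        ≈⟨ lemmaSum-between ⟩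
      ∑[ ⊥ ⊆ U ⊆ X ] ∑[ Y ⊆ V ⊆ B ] statement-term U V
        ≈⟨ ∑-between-cong ⊥ X (λ U _ U⊆X → ∑-between-cong Y B (shuffle-term≈statement-term U U⊆X)) ⟨
      ∑[ ⊥ ⊆ U ⊆ X ] ∑[ Y ⊆ V ⊆ B ] shuffle-term U V
        ≈⟨ shuffle-expansion ⟨
      shuffle 0 D D entries-AB
        ≈⟨ shuffle-vanish 0 D-alt D-alt entries-AB (subst₂ _<_ r≡ (≡.sym free≡) (ℕₚ.+-monoʳ-< ∣ B ─ Y ∣ ∣Y∣<∣X∣)) ⟩
      0# ∎
      where
      r≡ : ∣ B ─ Y ∣ ℕ.+ ∣ Y ∣ ≡ r
      r≡ = ≡.trans (∣─∣+∣∣ Y⊆B) ∣B∣≡r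
      free≡ : free-entries entries-AB ≡ ∣ B ─ Y ∣ ℕ.+ ∣ X ∣
      free≡ = ≡.trans (free-entries-++ (entries (column M) A X) _)
                      (≡.trans (≡.cong₂ ℕ._+_ (free-entries-entries _ A X X⊆A) (free-entries-entries _ B (B ─ Y) (p─q⊆p B Y)))
                               (ℕₚ.+-comm ∣ X ∣ _))

lemma5p4 : ∀ {c ℓ} (F : Field c ℓ) {r n : ℕ}
             (M : Fin r → Fin n → Field.Carrier F)
             (A B X Y : Subset n) →
             ∣ A ∣ ≡ r → ∣ B ∣ ≡ r →
             X ⊆ (A ─ B) → Y ⊆ (B ─ A) → ∣ Y ∣ < ∣ X ∣ →
             Field._≈_ F (lemmaSum (Field.commutativeRing F) M A B X Y) (Field.0# F)
lemma5p4 F M A B X Y ∣A∣≡r ∣B∣≡r X⊆A─B Y⊆B─A =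
  Lemma5p4.lemmaSum≈0 (Field.commutativeRing F) M A B X Y ∣A∣≡r ∣B∣≡r X⊆A─B Y⊆B─A
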